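{- If a gehm $\mathbb{H}$ is orientable, then $T(\mathbb{H};x,y)$ can be expanded as a polynomial in $x$ and $y$ (i.e., all exponents $\rho(\mathbb{H})-\rho(A)$ and $d(A)-|A|-\rho(A)$ in its defining sum are non-negative integers).
   Context: A gehm is a finite cubic graph whose edges are properly coloured with colours $b,g,r$, together with possibly some isolates ($g$-coloured edges meeting no vertex). It is orientable if it is bipartite. Hyperedges are $b$--$r$-cycles, hyperfaces are $b$--$g$-cycles or isolates, hypervertices are $g$--$r$-cycles or isolates. $E(\mathbb{H})$, $e(\mathbb{H})$, $v(\mathbb{H})$, $f(\mathbb{H})$ denote the set of hyperedges and numbers of hyperedges, hypervertices, hyperfaces; $k(\mathbb{H})$ is the number of components (isolates count); $d(e)$ is half the number of gehm-edges in hyperedge $e$, $d(A)=\sum_{e\in A}d(e)$, $d(\mathbb{H})=d(E(\mathbb{H}))$; $\gamma(\mathbb{H})=2k(\mathbb{H})-v(\mathbb{H})-e(\mathbb{H})+d(\mathbb{H})-f(\mathbb{H})$. Suppressing a degree-two vertex: if its only edge is a loop, replace it and the loop by an isolate; otherwise contract one incident edge. Deleting a hyperedge $e$: delete its $b$-edges, contract its $r$-edges, suppress degree-two vertices. For $A\subseteq E(\mathbb{H})$, $\mathbb{H}_{|A}$ is obtained by deleting all hyperedges not in $A$; $v(A),k(A),f(A),\gamma(A)$ are the quantities of $\mathbb{H}_{|A}$. $\rho(\mathbb{H})=v(\mathbb{H})-k(\mathbb{H})+\tfrac12\gamma(\mathbb{H})$, $\rho(A)=v(A)-k(A)+\tfrac12\gamma(A)$.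 $T(\mathbb{H};x,y)=\sum_{A\subseteq E(\mathbb{H})}(x-1)^{\rho(\mathbb{H})-\rho(A)}(y-1)^{d(A)-|A|-\rho(A)}$. -}

module Defs where

open import Data.Nat as ℕ using (ℕ; zero; suc; _<ᵇ_; ⌊_/2⌋)
open import Data.Fin using (Fin; toℕ; _≟_)
open import Data.Bool using (Bool; true; false; _∧_; _∨_; not; if_then_else_)
open import Data.List using (List; []; _∷_; allFin)
open import Data.Bool.ListAction using (any; all)
open import Data.Integer as ℤ using (ℤ; +_)
open import Data.Rational as ℚ using (ℚ; ½)
open import Data.Product using (Σ; _×_; ∃-syntax; _,_; proj₁)
open import Relation.Nullary.Decidable using (isYes)
open import Relation.Binary.PropositionalEquality using (_≡_; _≢_)

_==_ : ∀ {n} → Fin n → Fin n → Bool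
u == v = isYes (u ≟ v)

countB : ∀ {A : Set} → (A → Bool) → List A → ℕ
countB p []       = 0
countB p (x ∷ xs) = if p x then suc (countB p xs) else countB p xs

-- reach gens k u v : v can be reached from u by applying at most k
-- generators (all generators used here are involutions, so this is the
-- reachability relation of the graph whose edges are {w , f w}).
reach : ∀ {n} → List (Fin n → Fin n) → ℕ → Fin n → Fin n → Bool
reach gens zero    u v = u == v
reach gens (suc k) u v = reach gens k u v ∨ any (λ f → reach gens k u (f v)) gens

-- same orbit of the group generated by gens (paths of length < n suffice)
sameOrbit : ∀ {n} → List (Fin n → Fin n) → Fin n → Fin n → Bool
sameOrbit {n} gens u v = reach gens n u v

isRep : ∀ {n} → (Fin n → Bool) → List (Fin n → Fin n) → Fin n → Bool
isRep {n} live gens v =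
  live v ∧ all (λ u → not (live u ∧ (toℕ u <ᵇ toℕ v) ∧ sameOrbit gens u v)) (allFin n)

-- number of orbits of ⟨gens⟩ on the vertex set live
-- (= number of bicoloured cycles / components)
numOrbits : ∀ {n} → (Fin n → Bool) → List (Fin n → Fin n) → ℕ
numOrbits {n} live gens = countB (isRep live gens) (allFin n)

numEdges : ∀ {n} → (Fin n → Bool) → (Fin n → Fin n) → ℕ
numEdges {n} live f = countB (λ v → live v ∧ (toℕ v <ᵇ toℕ (f v))) (allFin n)

-- A gehm: a finite cubic graph on the vertex set Fin n whose edges are
-- properly 3-coloured b, g, r; equivalently three fixed-point-free
-- involutions b, g, r of Fin n (the colour classes, which are perfect
-- matchings; parallel edges of different colours are allowed), together
-- with a number iso of isolates.
record Gehm : Set where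
  field
    n   : ℕ
    b   : Fin n → Fin n
    g   : Fin n → Fin n
    r   : Fin n → Fin n
    iso : ℕ
    b-invol : ∀ v → b (b v) ≡ v
    g-invol : ∀ v → g (g v) ≡ v
    r-invol : ∀ v → r (r v) ≡ v
    b-noloop : ∀ v → b v ≢ v
    g-noloop : ∀ v → g v ≢ v
    r-noloop : ∀ v → r v ≢ v

open Gehm public

-- orientable = the underlying cubic graph is bipartite
Orientable : Gehm → Set
Orientable H = Σ (Fin (n H) → Bool) λ c →
  (∀ v → c (b H v) ≢ c v) × (∀ v → c (g H v) ≢ c v) × (∀ v → c (r H v) ≢ c v)

-- A set A ⊆ E(H) of hyperedges (b–r-cycles) is encoded by the set of
-- vertices of the hyperedges in A: a Boolean predicate on vertices which
-- is constant on every b–r-cycle.  This encoding is a bijection.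
HyperedgeSet : Gehm → Set
HyperedgeSet H = Σ (Fin (n H) → Bool) λ A →
  (∀ v → A (b H v) ≡ A v) × (∀ v → A (r H v) ≡ A v)

-- Raw data of a gehm whose vertex set is a subset live of Fin n
-- (used to describe H and H_{|A} uniformly)

record GehmData : Set where
  field
    dn    : ℕ
    live  : Fin dn → Bool
    db    : Fin dn → Fin dn
    dg    : Fin dn → Fin dn
    dr    : Fin dn → Fin dn
    diso  : ℕ

open GehmData public

toData : Gehm → GehmData
toData H = record { dn = n H ; live = λ _ → true ; db = b H ; dg = g H
                  ; dr = r H ; diso = iso H }

-- hyperedges = b–r-cycles
eD : GehmData → ℕ
eD D = numOrbits (live D) (db D ∷ dr D ∷ [])

-- hypervertices = g–r-cycles and isolates
vD : GehmData → ℕ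
vD D = numOrbits (live D) (dg D ∷ dr D ∷ []) ℕ.+ diso D

-- hyperfaces = b–g-cycles and isolates
fD : GehmData → ℕ
fD D = numOrbits (live D) (db D ∷ dg D ∷ []) ℕ.+ diso D

-- components (isolates count as components)
kD : GehmData → ℕ
kD D = numOrbits (live D) (db D ∷ dg D ∷ dr D ∷ []) ℕ.+ diso D

-- d = sum over hyperedges of half the number of gehm-edges (b- and
-- r-edges) in the hyperedge = half the total number of b- and r-edges
dD : GehmData → ℕ
dD D = ⌊ numEdges (live D) (db D) ℕ.+ numEdges (live D) (dr D) /2⌋

γD : GehmData → ℤ
γD D = ((((+ (2 ℕ.* kD D)) ℤ.- (+ vD D)) ℤ.- (+ eD D)) ℤ.+ (+ dD D)) ℤ.- (+ fD D)

ρD : GehmData → ℚ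
ρD D = ((+ vD D) ℚ./ 1 ℚ.- (+ kD D) ℚ./ 1) ℚ.+ ½ ℚ.* (γD D ℚ./ 1)

-- H_{|A}: delete every hyperedge not in A.
-- Deleting the b-edges and contracting the r-edges of the deleted
-- hyperedges and suppressing degree-two vertices leaves the vertices of
-- the hyperedges in A, with b and r unchanged; the new g-edge at a kept
-- vertex w runs along the path  w –g– x –r– r x –g– ...  through deleted
-- vertices until it reaches the first kept vertex.  Each g–r-cycle all
-- of whose vertices are deleted collapses to a loop and hence becomes an
-- isolate.

module _ (H : Gehm) (A : Fin (n H) → Bool) where

  ret : ℕ → Fin (n H) → Fin (n H)
  ret zero    x = x
  ret (suc k) x = if A x then x else ret k (g H (r H x))

  gRestr : Fin (n H) → Fin (n H)
  gRestr w = if A w then ret (n H) (g H w) else w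

  newIsolates : ℕ
  newIsolates = countB
    (λ v → isRep (λ _ → true) (g H ∷ r H ∷ []) v
           ∧ all (λ u → not (sameOrbit (g H ∷ r H ∷ []) v u ∧ A u)) (allFin (n H)))
    (allFin (n H))

  restrict : GehmData
  restrict = record { dn = n H ; live = A ; db = b H ; dg = gRestr
                    ; dr = r H ; diso = iso H ℕ.+ newIsolates }

ρ : Gehm → ℚ
ρ H = ρD (toData H)

ρA : (H : Gehm) → HyperedgeSet H → ℚ
ρA H A = ρD (restrict H (proj₁ A))

card : (H : Gehm) → HyperedgeSet H → ℕ
card H A = numOrbits (proj₁ A) (b H ∷ r H ∷ [])

dA : (H : Gehm) → HyperedgeSet H → ℕ
dA H A = ⌊ numEdges (proj₁ A) (b H) ℕ.+ numEdges (proj₁ A) (r H) /2⌋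

_≡ℕ : ℚ → Set
q ≡ℕ = ∃[ m ] (q ≡ (+ m) ℚ./ 1)

{-# OPTIONS --safe #-}
module Submission where

-- Since k cancels, 2ρ = v + d − e − f, and both exponents are halves of defects in a
-- triangle inequality for perfect matchings: for perfect matchings p, q, t of a
-- bipartite graph, #cycles(q ∪ t) + |p| − #cycles(p ∪ q) − #cycles(p ∪ t) is even and
-- non-negative.  Induct on the distance from t to p: switching the t-edges at x and p x
-- adds one p–t cycle and changes the number of q–t cycles by ±1, never by 0 because the
-- graph is bipartite.  With s = b on the hyperedges of A and s = r elsewhere, the g–s
-- cycles of H are the b–g cycles of H_{|A} plus its new isolates, and the g–r cycles of
-- H are those of H_{|A} plus the same isolates; so the defects of (b, g, s) and
-- (r, g, s) are 2(ρ(H) − ρ(A)) and 2(d(A) − |A| − ρ(A)).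

open import Defs
open import Data.Bool using (Bool; true; false; _∧_; _∨_; not; if_then_else_; T)
open import Data.Bool.ListAction using (any; all)
open import Data.Bool.Properties using (∧-comm; ∧-identityʳ; ∧-zeroʳ)
open import Data.Empty using (⊥-elim)
open import Data.Fin as F using (Fin; toℕ)
open import Data.Fin.Properties as FP using (toℕ-injective; pigeonhole; any?)
open import Data.Integer as ℤ using (ℤ; +_)
open import Data.Integer.Properties using (pos-+; pos-*)
open import Data.Integer.Tactic.RingSolver using (solve-∀)
open import Data.List using (List; []; _∷_; allFin; _++_; take; drop; length)
open import Data.List.Membership.Propositional using (_∈_)
open import Data.List.Membership.Propositional.Properties using (∈-allFin)
open import Data.List.Properties using (take++drop≡id; length-++; length-take; length-drop)
open import Data.List.Relation.Unary.All as All using (All; []; _∷_)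
open import Data.List.Relation.Unary.All.Properties using (++⁺; take⁺; drop⁺)
open import Data.List.Relation.Unary.AllPairs using (_∷_)
open import Data.List.Relation.Unary.Any using (here; there)
open import Data.List.Relation.Unary.Unique.Propositional using (Unique)
open import Data.List.Relation.Unary.Unique.Propositional.Properties using (allFin⁺)
open import Data.Nat as ℕ using (ℕ; zero; suc; _+_; _*_; _∸_; _<ᵇ_; _≤_; _<_; z≤n; s≤s; ⌊_/2⌋)
open import Data.Nat.GeneralisedArithmetic using (fold; fold-+)
open import Data.Nat.Properties as ℕP
  using ( ≤-refl; ≤-reflexive; ≤-trans; ≤-antisym; <-trans; <-≤-trans; ≤-<-trans; <⇒≤; <⇒≤pred; <-cmp
        ; m≤n⇒m<n∨m≡n; ≰⇒>; n<1+n; m<n⇒0<n∸m; m∸n≤m; m+[n∸m]≡n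
        ; +-comm; +-suc; +-identityʳ; n≡⌊n+n/2⌋ )
open import Data.Nat.Tactic.RingSolver using () renaming (solve-∀ to solve-∀ℕ)
open import Data.Product using (Σ; _×_; _,_; proj₁; proj₂)
open import Data.Rational as ℚ using (½; toℚᵘ; _-_; _/_)
open import Data.Rational.Properties using (toℚᵘ-injective; toℚᵘ-fromℚᵘ; toℚᵘ-homo-+; toℚᵘ-homo‿-; toℚᵘ-homo-*)
open import Data.Rational.Unnormalised as ℚᵘ using (mkℚᵘ; *≡*) renaming (_≃_ to _≃ᵘ_)
open import Data.Rational.Unnormalised.Properties using (≃-trans; ≃-sym; ≃-refl; +-cong; -‿cong; *-cong)
open import Data.Sum as Sum using (_⊎_; inj₁; inj₂)
open import Data.Unit using (⊤)
open import Function using (_∘′_; case_of_)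
open import Relation.Binary using (IsEquivalence; tri<; tri≈; tri>)
open import Relation.Binary.PropositionalEquality hiding (J)
open import Relation.Nullary using (¬_; Dec; yes; no)
open import Relation.Nullary.Decidable using (¬?; decidable-stable)

∧⁺ : ∀ {x y} → x ≡ true → y ≡ true → x ∧ y ≡ true
∧⁺ refl refl = refl

∧⁻ : ∀ {x y} → x ∧ y ≡ true → x ≡ true × y ≡ true
∧⁻ {true} {true} _ = refl , refl

∨⁺ˡ : ∀ {x} y → x ≡ true → x ∨ y ≡ true
∨⁺ˡ y refl = refl

∨⁺ʳ : ∀ x {y} → y ≡ true → x ∨ y ≡ true
∨⁺ʳ false refl = refl
∨⁺ʳ true  refl = refl

∨⁻ : ∀ x {y} → x ∨ y ≡ true → x ≡ true ⊎ y ≡ true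
∨⁻ true  _ = inj₁ refl
∨⁻ false e = inj₂ e

not⁺ : ∀ {x} → x ≡ false → not x ≡ true
not⁺ refl = refl

not⁻ : ∀ {x} → not x ≡ true → x ≡ false
not⁻ {false} _ = refl

≡true⇒≢false : ∀ {x} → x ≡ true → x ≢ false
≡true⇒≢false refl ()

≢true⇒≡false : ∀ {x} → x ≢ true → x ≡ false
≢true⇒≡false {false} _ = refl
≢true⇒≡false {true}  h = ⊥-elim (h refl)

bool-ext : ∀ {x y} → (x ≡ true → y ≡ true) → (y ≡ true → x ≡ true) → x ≡ y
bool-ext {true}  {true}  _ _ = refl
bool-ext {true}  {false} f _ = sym (f refl)
bool-ext {false} {true}  _ g = g refl
bool-ext {false} {false} _ _ = refl

<ᵇ⁺ : ∀ {m k} → m < k → (m <ᵇ k) ≡ true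
<ᵇ⁺ {m} {k} lt with m <ᵇ k | ℕP.<⇒<ᵇ lt
... | true | _ = refl

<ᵇ⁻ : ∀ {m k} → (m <ᵇ k) ≡ true → m < k
<ᵇ⁻ {m} {k} e = ℕP.<ᵇ⇒< m k (subst T (sym e) _)

module _ {A : Set} where

  any⁺ : ∀ (p : A → Bool) {xs x} → x ∈ xs → p x ≡ true → any p xs ≡ true
  any⁺ p {x ∷ xs} (here refl) e = ∨⁺ˡ (any p xs) e
  any⁺ p {y ∷ xs} (there m)   e = ∨⁺ʳ (p y) (any⁺ p m e)

  any⁻ : ∀ (p : A → Bool) xs → any p xs ≡ true → Σ A λ x → x ∈ xs × p x ≡ true
  any⁻ p (x ∷ xs) e with ∨⁻ (p x) e
  ... | inj₁ px = x , here refl , px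
  ... | inj₂ pxs with any⁻ p xs pxs
  ...   | y , y∈ , py = y , there y∈ , py

  all⁺ : ∀ (p : A → Bool) xs → (∀ x → x ∈ xs → p x ≡ true) → all p xs ≡ true
  all⁺ p []       h = refl
  all⁺ p (x ∷ xs) h = ∧⁺ (h x (here refl)) (all⁺ p xs λ y y∈ → h y (there y∈))

  all⁻ : ∀ (p : A → Bool) {xs x} → all p xs ≡ true → x ∈ xs → p x ≡ true
  all⁻ p e (here refl) = proj₁ (∧⁻ e)
  all⁻ p {y ∷ _} e (there x∈) = all⁻ p (proj₂ (∧⁻ {p y} e)) x∈

  all-false⁻ : ∀ (p : A → Bool) xs → all p xs ≡ false → Σ A λ x → x ∈ xs × p x ≡ false
  all-false⁻ p (x ∷ xs) e with p x in px
  ... | false = x , here refl , px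
  ... | true with all-false⁻ p xs e
  ...   | y , y∈ , py = y , there y∈ , py

  all-cong : ∀ {p q : A → Bool} xs → (∀ x → p x ≡ q x) → all p xs ≡ all q xs
  all-cong []       h = refl
  all-cong (x ∷ xs) h = cong₂ _∧_ (h x) (all-cong xs h)

  countB-cong : ∀ {p q : A → Bool} xs → (∀ x → p x ≡ q x) → countB p xs ≡ countB q xs
  countB-cong [] eq = refl
  countB-cong {p} {q} (x ∷ xs) eq rewrite eq x with q x
  ... | true  = cong suc (countB-cong xs eq)
  ... | false = countB-cong xs eq

  countB-split : ∀ (p q : A → Bool) xs →
    countB p xs ≡ countB (λ x → p x ∧ q x) xs + countB (λ x → p x ∧ not (q x)) xs
  countB-split p q [] = refl
  countB-split p q (x ∷ xs) with p x | q x
  ... | true  | true  = cong suc (countB-split p q xs)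
  ... | true  | false = trans (cong suc (countB-split p q xs)) (sym (+-suc _ _))
  ... | false | _     = countB-split p q xs

  countB-pos : ∀ (p : A → Bool) {xs x} → x ∈ xs → p x ≡ true → 1 ≤ countB p xs
  countB-pos p {y ∷ xs} (here refl) e rewrite e = s≤s z≤n
  countB-pos p {y ∷ xs} (there m) e with p y
  ... | true  = s≤s z≤n
  ... | false = countB-pos p m e

  countB-< : ∀ (p q : A → Bool) {xs x₀} → x₀ ∈ xs → (∀ x → p x ≡ true → q x ≡ true) → q x₀ ≡ true → p x₀ ≡ false →
    countB p xs < countB q xs
  countB-< p q {xs} {x₀} x₀∈ p⊆q qx₀ px₀ = begin-strict
    countB p xs                                                       ≡⟨ countB-cong xs p≡q∧p ⟩
    countB (λ x → q x ∧ p x) xs                                       <⟨ ℕP.m<m+n _ (countB-pos _ x₀∈ (∧⁺ qx₀ (not⁺ px₀))) ⟩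
    countB (λ x → q x ∧ p x) xs + countB (λ x → q x ∧ not (p x)) xs  ≡⟨ countB-split q p xs ⟨
    countB q xs                                                       ∎
    where
    open ℕP.≤-Reasoning
    p≡q∧p : ∀ x → p x ≡ (q x ∧ p x)
    p≡q∧p x with p x in px
    ... | true  rewrite p⊆q x px = refl
    ... | false with q x
    ...   | true  = refl
    ...   | false = refl

module _ {n : ℕ} where

  ==⁺ : ∀ {u v : Fin n} → u ≡ v → (u == v) ≡ true
  ==⁺ {u} refl with u F.≟ u
  ... | yes _ = refl
  ... | no ne = ⊥-elim (ne refl)

  ==-refl : ∀ (v : Fin n) → (v == v) ≡ true
  ==-refl v = ==⁺ refl

  ==⁻ : ∀ {u v : Fin n} → (u == v) ≡ true → u ≡ v
  ==⁻ {u} {v} e with u F.≟ v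
  ... | yes eq = eq

  ==-false : ∀ {u v : Fin n} → u ≢ v → (u == v) ≡ false
  ==-false {u} {v} ne with u F.≟ v
  ... | yes e = ⊥-elim (ne e)
  ... | no _  = refl

  remove : Fin n → List (Fin n) → List (Fin n)
  remove y [] = []
  remove y (z ∷ zs) with y F.≟ z
  ... | yes _ = zs
  ... | no _  = z ∷ remove y zs

  countB-remove : ∀ (q : Fin n → Bool) {y} ys → y ∈ ys → q y ≡ true →
    countB q ys ≡ suc (countB q (remove y ys))
  countB-remove q {y} (z ∷ zs) m e with y F.≟ z
  ... | yes refl rewrite e = refl
  countB-remove q (z ∷ zs) (here refl) e | no ne = ⊥-elim (ne refl)
  countB-remove q (z ∷ zs) (there m)   e | no _ with q z
  ... | true  = cong suc (countB-remove q zs m e)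
  ... | false = countB-remove q zs m e

  ∈-remove : ∀ {y y′} ys → y′ ∈ ys → y′ ≢ y → y′ ∈ remove y ys
  ∈-remove {y} (z ∷ zs) m ne with y F.≟ z
  ∈-remove (z ∷ zs) (here refl) ne | yes refl = ⊥-elim (ne refl)
  ∈-remove (z ∷ zs) (there m)   ne | yes refl = m
  ∈-remove (z ∷ zs) (here refl) ne | no _ = here refl
  ∈-remove (z ∷ zs) (there m)   ne | no _ = there (∈-remove zs m ne)

  countB-≤-injection : ∀ (p q : Fin n → Bool) (Φ : Fin n → Fin n → Set) xs ys → Unique xs →
    (∀ x → x ∈ xs → p x ≡ true → Σ (Fin n) λ y → y ∈ ys × q y ≡ true × Φ x y) →
    (∀ x x′ y → p x ≡ true → p x′ ≡ true → Φ x y → Φ x′ y → x ≡ x′) →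
    countB p xs ≤ countB q ys
  countB-≤-injection p q Φ [] ys _ _ _ = z≤n
  countB-≤-injection p q Φ (x ∷ xs) ys (x∉ ∷ u) ex inj with p x in px
  ... | false = countB-≤-injection p q Φ xs ys u (λ x′ m → ex x′ (there m)) inj
  ... | true with ex x (here refl) px
  ...   | y , y∈ , qy , φxy =
    ≤-trans (s≤s rest) (≤-reflexive (sym (countB-remove q ys y∈ qy)))
    where
    rest : countB p xs ≤ countB q (remove y ys)
    rest = countB-≤-injection p q Φ xs (remove y ys) u
      (λ x′ m e → let (y′ , y′∈ , qy′ , φ′) = ex x′ (there m) e in
         y′ , ∈-remove ys y′∈ (λ y′≡y → All.lookup x∉ m (inj x x′ y px e φxy (subst (Φ x′) y′≡y φ′))) , qy′ , φ′)
      inj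

  countB-≡-bijection : ∀ (p q : Fin n → Bool) (Φ : Fin n → Fin n → Set) →
    (∀ x → p x ≡ true → Σ (Fin n) λ y → q y ≡ true × Φ x y) →
    (∀ y → q y ≡ true → Σ (Fin n) λ x → p x ≡ true × Φ x y) →
    (∀ x x′ y → p x ≡ true → p x′ ≡ true → Φ x y → Φ x′ y → x ≡ x′) →
    (∀ x y y′ → q y ≡ true → q y′ ≡ true → Φ x y → Φ x y′ → y ≡ y′) →
    countB p (allFin n) ≡ countB q (allFin n)
  countB-≡-bijection p q Φ ex₁ ex₂ inj₁′ inj₂′ = ≤-antisym
    (countB-≤-injection p q Φ (allFin n) (allFin n) (allFin⁺ n)
       (λ x _ e → let (y , qy , φ) = ex₁ x e in y , ∈-allFin y , qy , φ) inj₁′)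
    (countB-≤-injection q p (λ y x → Φ x y) (allFin n) (allFin n) (allFin⁺ n)
       (λ y _ e → let (x , px , φ) = ex₂ y e in x , ∈-allFin x , px , φ) (λ y y′ x → inj₂′ x y y′))

  countB-singleton : ∀ (p : Fin n → Bool) m → p m ≡ true → (∀ v → p v ≡ true → v ≡ m) →
    countB p (allFin n) ≡ 1
  countB-singleton p m pm uq = ≤-antisym
    (countB-≤-injection p (λ _ → true) _≡_ (allFin n) (m ∷ []) (allFin⁺ n)
      (λ x _ e → m , here refl , refl , uq x e) (λ x x′ y _ _ e₁ e₂ → trans e₁ (sym e₂)))
    (countB-pos p (∈-allFin m) pm)

Gens : ℕ → Set
Gens n = List (Fin n → Fin n)

module _ {n : ℕ} where

  applyAll : Gens n → Fin n → Fin n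
  applyAll []       v = v
  applyAll (f ∷ fs) v = applyAll fs (f v)

  applyAll-++ : ∀ fs hs v → applyAll (fs ++ hs) v ≡ applyAll hs (applyAll fs v)
  applyAll-++ []       hs v = refl
  applyAll-++ (f ∷ fs) hs v = applyAll-++ fs hs (f v)

  Conn : Gens n → Fin n → Fin n → Set
  Conn gs u v = Σ (Gens n) λ fs → All (_∈ gs) fs × applyAll fs v ≡ u

  Conn-refl : ∀ {gs} v → Conn gs v v
  Conn-refl v = [] , [] , refl

  Conn-trans : ∀ {gs u w v} → Conn gs u w → Conn gs w v → Conn gs u v
  Conn-trans (fs₂ , a₂ , e₂) (fs₁ , a₁ , e₁) =
    fs₁ ++ fs₂ , ++⁺ a₁ a₂ , trans (applyAll-++ fs₁ fs₂ _) (trans (cong (applyAll fs₂) e₁) e₂)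

  Conn-step : ∀ {gs f} → f ∈ gs → ∀ v → Conn gs (f v) v
  Conn-step m v = _ ∷ [] , m ∷ [] , refl

  Conn-closed : ∀ {gs} (S : Fin n → Set) → (∀ {f} → f ∈ gs → ∀ x → S x → S (f x)) →
    ∀ {u v} → S v → Conn gs u v → S u
  Conn-closed S cl sv ([] , [] , refl) = sv
  Conn-closed S cl sv (f ∷ fs , m ∷ ms , e) = Conn-closed S cl (cl m _ sv) (fs , ms , e)

  Invol : Gens n → Set
  Invol gs = ∀ {f} → f ∈ gs → ∀ x → f (f x) ≡ x

  Conn-sym : ∀ {gs} → Invol gs → ∀ {u v} → Conn gs u v → Conn gs v u
  Conn-sym {gs} inv {u} {v} = Conn-closed (Conn gs v) back (Conn-refl v)
    where
    back : ∀ {f} → f ∈ gs → ∀ x → Conn gs v x → Conn gs v (f x)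
    back {f} m x c = Conn-trans c (subst (λ y → Conn gs y (f x)) (inv m x) (Conn-step m (f x)))

  Conn-mono-on : ∀ {gs hs} (P : Fin n → Set) → (∀ {f} → f ∈ gs → ∀ x → P x → P (f x) × Conn hs (f x) x) →
    ∀ {u v} → P v → Conn gs u v → Conn hs u v
  Conn-mono-on {gs} {hs} P st {u} {v} pv c =
    proj₂ (Conn-closed (λ x → P x × Conn hs x v)
      (λ m x (px , c′) → proj₁ (st m x px) , Conn-trans (proj₂ (st m x px)) c′) (pv , Conn-refl v) c)

  Conn-mono : ∀ {gs hs} → (∀ {f} → f ∈ gs → ∀ x → Conn hs (f x) x) → ∀ {u v} → Conn gs u v → Conn hs u v
  Conn-mono st = Conn-mono-on (λ _ → ⊤) (λ m x _ → _ , st m x) _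

  reach-sound : ∀ gs k u v → reach gs k u v ≡ true → Conn gs u v
  reach-sound gs zero u v e rewrite ==⁻ e = Conn-refl v
  reach-sound gs (suc k) u v e with ∨⁻ (reach gs k u v) e
  ... | inj₁ e₁ = reach-sound gs k u v e₁
  ... | inj₂ e₂ with any⁻ (λ f → reach gs k u (f v)) gs e₂
  ...   | f , f∈ , e₃ = Conn-trans (reach-sound gs k u (f v) e₃) (Conn-step f∈ v)

  reach-complete : ∀ gs k u v fs → All (_∈ gs) fs → length fs ≤ k → applyAll fs v ≡ u → reach gs k u v ≡ true
  reach-complete gs zero    u v []       []       z≤n      refl = ==⁺ refl
  reach-complete gs (suc k) u v []       []       _        refl = ∨⁺ˡ _ (reach-complete gs k v v [] [] z≤n refl)
  reach-complete gs (suc k) u v (f ∷ fs) (m ∷ ms) (s≤s le) e =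
    ∨⁺ʳ (reach gs k u v) (any⁺ (λ f → reach gs k u (f v)) m (reach-complete gs k u (f v) fs ms le e))

  shortcut : ∀ {gs u v} fs → n < length fs → All (_∈ gs) fs → applyAll fs v ≡ u →
    Σ (Gens n) λ fs′ → length fs′ < length fs × All (_∈ gs) fs′ × applyAll fs′ v ≡ u
  shortcut {u = u} {v} fs n<k ms e with pigeonhole (ℕP.m<n⇒m<1+n n<k) (λ i → applyAll (take (toℕ i) fs) v)
  ... | i , j , i<j , loop = fs′ , shorter , ++⁺ (take⁺ (toℕ i) ms) (drop⁺ (toℕ j) ms) , skips
    where
    k = length fs
    fs′ = take (toℕ i) fs ++ drop (toℕ j) fs
    j≤k : toℕ j ≤ k
    j≤k = <⇒≤pred (FP.toℕ<n j)
    skips : applyAll fs′ v ≡ u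
    skips = begin
      applyAll fs′ v                                             ≡⟨ applyAll-++ (take (toℕ i) fs) _ v ⟩
      applyAll (drop (toℕ j) fs) (applyAll (take (toℕ i) fs) v)  ≡⟨ cong (applyAll (drop (toℕ j) fs)) loop ⟩
      applyAll (drop (toℕ j) fs) (applyAll (take (toℕ j) fs) v)  ≡⟨ applyAll-++ (take (toℕ j) fs) _ v ⟨
      applyAll (take (toℕ j) fs ++ drop (toℕ j) fs) v            ≡⟨ cong (λ hs → applyAll hs v) (take++drop≡id (toℕ j) fs) ⟩
      applyAll fs v                                              ≡⟨ e ⟩
      u                                                          ∎
      where open ≡-Reasoning
    shorter : length fs′ < k
    shorter = begin-strict
      length fs′                                          ≡⟨ length-++ (take (toℕ i) fs) ⟩
      length (take (toℕ i) fs) + length (drop (toℕ j) fs) ≡⟨ cong₂ _+_ (length-take (toℕ i) fs) (length-drop (toℕ j) fs) ⟩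
      toℕ i ℕ.⊓ k + (k ∸ toℕ j)                         ≤⟨ ℕP.+-monoˡ-≤ _ (ℕP.m⊓n≤m (toℕ i) k) ⟩
      toℕ i + (k ∸ toℕ j)                               <⟨ ℕP.+-monoˡ-< (k ∸ toℕ j) i<j ⟩
      toℕ j + (k ∸ toℕ j)                               ≡⟨ m+[n∸m]≡n j≤k ⟩
      k                                                   ∎
      where open ℕP.≤-Reasoning

  bounded-path : ∀ {gs u v} fuel fs → length fs ≤ fuel → All (_∈ gs) fs → applyAll fs v ≡ u →
    Σ (Gens n) λ fs′ → length fs′ ≤ n × All (_∈ gs) fs′ × applyAll fs′ v ≡ u
  bounded-path fuel fs le ms e with length fs ℕ.≤? n
  ... | yes short = fs , short , ms , e
  ... | no long with shortcut fs (≰⇒> long) ms e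
  bounded-path zero       fs le ms e | no long | _ = ⊥-elim (long (≤-trans le z≤n))
  bounded-path (suc fuel) fs le ms e | no long | fs′ , lt , ms′ , e′ =
    bounded-path fuel fs′ (ℕP.≤-pred (<-≤-trans lt le)) ms′ e′

  sameOrbit-complete : ∀ gs {u v} → Conn gs u v → sameOrbit gs u v ≡ true
  sameOrbit-complete gs {u} {v} (fs , ms , e) with bounded-path (length fs) fs ≤-refl ms e
  ... | fs′ , le , ms′ , e′ = reach-complete gs n u v fs′ ms′ le e′

  sameOrbit-sound : ∀ gs {u v} → sameOrbit gs u v ≡ true → Conn gs u v
  sameOrbit-sound gs {u} {v} = reach-sound gs n u v

least-Fin : ∀ {m} (p : Fin m → Bool) a → p a ≡ true →
  Σ (Fin m) λ z → p z ≡ true × (∀ u → toℕ u < toℕ z → p u ≡ false)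
least-Fin {suc m} p a pa with p F.zero in p0
... | true = F.zero , p0 , λ u ()
least-Fin {suc m} p F.zero      pa | false = ⊥-elim (≡true⇒≢false pa p0)
least-Fin {suc m} p (F.suc a) pa | false with least-Fin (λ i → p (F.suc i)) a pa
... | z , pz , below = F.suc z , pz , below′
  where
  below′ : ∀ u → toℕ u < suc (toℕ z) → p u ≡ false
  below′ F.zero    _        = p0
  below′ (F.suc u) (s≤s lt) = below u lt

module _ {n : ℕ} where

  everywhere : Fin n → Bool
  everywhere _ = true

  isRepᴿ : (Fin n → Bool) → (Fin n → Fin n → Bool) → Fin n → Bool
  isRepᴿ L R v = L v ∧ all (λ u → not (L u ∧ (toℕ u <ᵇ toℕ v) ∧ R u v)) (allFin n)

  module Reps (R : Fin n → Fin n → Bool) where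

    isRepᴿ-live : ∀ L {v} → isRepᴿ L R v ≡ true → L v ≡ true
    isRepᴿ-live L e = proj₁ (∧⁻ e)

    isRepᴿ-least : ∀ L {v} → isRepᴿ L R v ≡ true → ∀ u → L u ≡ true → toℕ u < toℕ v → R u v ≡ false
    isRepᴿ-least L {v} e u lu lt with R u v in ruv
    ... | false = refl
    ... | true = ⊥-elim (≡true⇒≢false (∧⁺ lu (∧⁺ (<ᵇ⁺ lt) ruv))
                   (not⁻ (all⁻ _ (proj₂ (∧⁻ {L v} e)) (∈-allFin u))))

    isRepᴿ⁺ : ∀ L {v} → L v ≡ true → (∀ u → L u ≡ true → toℕ u < toℕ v → R u v ≡ false) → isRepᴿ L R v ≡ true
    isRepᴿ⁺ L {v} lv least = ∧⁺ lv (all⁺ _ (allFin n) λ u _ → not⁺ (no-smaller u))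
      where
      no-smaller : ∀ u → (L u ∧ (toℕ u <ᵇ toℕ v) ∧ R u v) ≡ false
      no-smaller u with L u in lu | toℕ u <ᵇ toℕ v in lt
      ... | false | _     = refl
      ... | true  | false = refl
      ... | true  | true  = least u lu (<ᵇ⁻ lt)

    avoids : (Fin n → Bool) → Fin n → Bool
    avoids L v = all (λ u → not (R v u ∧ L u)) (allFin n)

  module Classes {R : Fin n → Fin n → Bool} (isEq : IsEquivalence (λ u v → R u v ≡ true)) where
    private module E = IsEquivalence isEq

    open Reps R public

    numClasses : (Fin n → Bool) → ℕ
    numClasses L = countB (isRepᴿ L R) (allFin n)

    rep-exists : ∀ L v → L v ≡ true → Σ (Fin n) λ m → isRepᴿ L R m ≡ true × R m v ≡ true
    rep-exists L v lv with least-Fin (λ u → L u ∧ R u v) v (∧⁺ lv E.refl)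
    ... | m , pm , below = m , isRepᴿ⁺ L (proj₁ (∧⁻ pm)) least , proj₂ (∧⁻ {L m} pm)
      where
      least : ∀ u → L u ≡ true → toℕ u < toℕ m → R u m ≡ false
      least u lu lt with R u m in rum
      ... | false = refl
      ... | true  = ⊥-elim (≡true⇒≢false (∧⁺ lu (E.trans rum (proj₂ (∧⁻ {L m} pm)))) (below u lt))

    rep-unique : ∀ L {v v′} → isRepᴿ L R v ≡ true → isRepᴿ L R v′ ≡ true → R v v′ ≡ true → v ≡ v′
    rep-unique L {v} {v′} r r′ e with <-cmp (toℕ v) (toℕ v′)
    ... | tri< lt _ _ = ⊥-elim (≡true⇒≢false e (isRepᴿ-least L r′ v (isRepᴿ-live L r) lt))
    ... | tri≈ _ eq _ = toℕ-injective eq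
    ... | tri> _ _ gt = ⊥-elim (≡true⇒≢false (E.sym e) (isRepᴿ-least L r v′ (isRepᴿ-live L r′) gt))

    non-rep-has-smaller : ∀ L {v} → L v ≡ true → isRepᴿ L R v ≡ false →
      Σ (Fin n) λ u → L u ≡ true × toℕ u < toℕ v × R u v ≡ true
    non-rep-has-smaller L {v} lv nr with rep-exists L v lv
    ... | m , rm , e with <-cmp (toℕ m) (toℕ v)
    ... | tri< lt _ _ = m , isRepᴿ-live L rm , lt , e
    ... | tri≈ _ eq _ = ⊥-elim (≡true⇒≢false (subst (λ z → isRepᴿ L R z ≡ true) (toℕ-injective eq) rm) nr)
    ... | tri> _ _ gt = ⊥-elim (≡true⇒≢false (E.sym e) (isRepᴿ-least L rm v lv gt))

    Closed : (Fin n → Bool) → Set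
    Closed L = ∀ {u v} → R u v ≡ true → L v ≡ true → L u ≡ true

    isRepᴿ-restrict : ∀ L → Closed L → ∀ v → (isRepᴿ everywhere R v ∧ L v) ≡ isRepᴿ L R v
    isRepᴿ-restrict L closed v = bool-ext to from
      where
      to : (isRepᴿ everywhere R v ∧ L v) ≡ true → isRepᴿ L R v ≡ true
      to e with ∧⁻ {isRepᴿ everywhere R v} e
      ... | r , lv = isRepᴿ⁺ L lv (λ u _ lt → isRepᴿ-least everywhere r u refl lt)
      from : isRepᴿ L R v ≡ true → (isRepᴿ everywhere R v ∧ L v) ≡ true
      from r = ∧⁺ (isRepᴿ⁺ everywhere refl least) (isRepᴿ-live L r)
        where
        least : ∀ u → true ≡ true → toℕ u < toℕ v → R u v ≡ false
        least u _ lt with R u v in ruv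
        ... | false = refl
        ... | true  = trans (sym ruv) (isRepᴿ-least L r u (closed ruv (isRepᴿ-live L r)) lt)

    numClasses-partition : ∀ L → Closed L → numClasses everywhere ≡ numClasses L + numClasses (λ v → not (L v))
    numClasses-partition L closed = trans (countB-split (isRepᴿ everywhere R) L (allFin n))
      (cong₂ _+_ (countB-cong (allFin n) (isRepᴿ-restrict L closed))
                 (countB-cong (allFin n) (isRepᴿ-restrict (λ v → not (L v)) closed-not)))
      where
      closed-not : Closed (λ v → not (L v))
      closed-not {u} {v} e lv with L u in lu
      ... | false = refl
      ... | true  = ⊥-elim (≡true⇒≢false (closed (E.sym e) lu) (not⁻ lv))

    numClasses-meeting : ∀ L →
      countB (λ v → isRepᴿ everywhere R v ∧ not (avoids L v)) (allFin n) ≡ numClasses L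
    numClasses-meeting L = countB-≡-bijection _ _ (λ x y → R x y ≡ true) to from
      (λ x x′ y p p′ e e′ → rep-unique everywhere (proj₁ (∧⁻ {isRepᴿ everywhere R x} p))
                              (proj₁ (∧⁻ {isRepᴿ everywhere R x′} p′)) (E.trans e (E.sym e′)))
      (λ x y y′ q q′ e e′ → rep-unique L q q′ (E.trans (E.sym e) e′))
      where
      to : ∀ x → (isRepᴿ everywhere R x ∧ not (avoids L x)) ≡ true →
        Σ (Fin n) λ y → isRepᴿ L R y ≡ true × R x y ≡ true
      to x e with all-false⁻ _ (allFin n) (not⁻ (proj₂ (∧⁻ {isRepᴿ everywhere R x} e)))
      ... | u , _ , meets with R x u in rxu | L u in lu
      ... | false | _     = ⊥-elim (≡true⇒≢false refl meets)
      ... | true  | false = ⊥-elim (≡true⇒≢false refl meets)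
      ... | true  | true with rep-exists L u lu
      ...   | y , ry , ryu = y , ry , E.trans rxu (E.sym ryu)
      from : ∀ y → isRepᴿ L R y ≡ true → Σ (Fin n) λ x → (isRepᴿ everywhere R x ∧ not (avoids L x)) ≡ true × R x y ≡ true
      from y ry with rep-exists everywhere y refl
      ... | x , rx , rxy = x , ∧⁺ rx (not⁺ meets) , rxy
        where
        meets : avoids L x ≡ false
        meets = ≢true⇒≡false λ av → ≡true⇒≢false (∧⁺ rxy (isRepᴿ-live L ry)) (not⁻ (all⁻ _ av (∈-allFin y)))

  module Refinement {R R′ : Fin n → Fin n → Bool}
    (isEq : IsEquivalence (λ u v → R u v ≡ true)) (isEq′ : IsEquivalence (λ u v → R′ u v ≡ true))
    (R′⊆R : ∀ {u v} → R′ u v ≡ true → R u v ≡ true) where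
    private
      module E = IsEquivalence isEq
      module E′ = IsEquivalence isEq′
      module C = Classes isEq
      module C′ = Classes isEq′

    rep-refine : ∀ v → isRepᴿ everywhere R v ≡ true → isRepᴿ everywhere R′ v ≡ true
    rep-refine v r = C′.isRepᴿ⁺ everywhere refl least
      where
      least : ∀ u → true ≡ true → toℕ u < toℕ v → R′ u v ≡ false
      least u _ lt with R′ u v in r′uv
      ... | false = refl
      ... | true  = trans (sym (R′⊆R r′uv)) (C.isRepᴿ-least everywhere r u refl lt)

    -- The R-class of a splits into the R′-classes of a and b.  Its old representative m
    -- still represents the R′-class of a, so the only new representative is the least
    -- element of the R′-class of b.
    one-new-rep : ∀ (a b m : Fin n) → isRepᴿ everywhere R m ≡ true → R′ m a ≡ true → R′ a b ≡ false → R a b ≡ true →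
      (∀ v → R v a ≡ true → R′ v a ≡ true ⊎ R′ v b ≡ true) →
      (∀ u v → R u v ≡ true → R′ u v ≡ true ⊎ R v a ≡ true) →
      countB (λ v → isRepᴿ everywhere R′ v ∧ not (isRepᴿ everywhere R v)) (allFin n) ≡ 1
    one-new-rep a b m₀ rm₀ r′m₀a r′ab≡false rab class-a R-via-a with C′.rep-exists everywhere b refl
    ... | m , rm , r′mb = countB-singleton _ m (∧⁺ rm (not⁺ m-not-old)) unique
      where
      r′m₀b≡false : R′ m₀ b ≡ false
      r′m₀b≡false = ≢true⇒≡false λ r′m₀b → ≡true⇒≢false (E′.trans (E′.sym r′m₀a) r′m₀b) r′ab≡false
      m-not-old : isRepᴿ everywhere R m ≡ false
      m-not-old = ≢true⇒≡false λ rm-old →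
        let m₀≡m = C.rep-unique everywhere rm₀ rm-old (E.trans (R′⊆R r′m₀a) (E.trans rab (E.sym (R′⊆R r′mb))))
        in ≡true⇒≢false (subst (λ z → R′ z b ≡ true) (sym m₀≡m) r′mb) r′m₀b≡false
      unique : ∀ v → (isRepᴿ everywhere R′ v ∧ not (isRepᴿ everywhere R v)) ≡ true → v ≡ m
      unique v e with ∧⁻ {isRepᴿ everywhere R′ v} e
      ... | rv′ , not-old with R v a in rva
      ... | true with class-a v rva
      ...   | inj₁ r′va = ⊥-elim (≡true⇒≢false (subst (λ z → isRepᴿ everywhere R z ≡ true) (sym v≡m₀) rm₀) (not⁻ not-old))
        where
        v≡m₀ : v ≡ m₀
        v≡m₀ = C′.rep-unique everywhere rv′ (rep-refine m₀ rm₀) (E′.trans r′va (E′.sym r′m₀a))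
      ...   | inj₂ r′vb = C′.rep-unique everywhere rv′ rm (E′.trans r′vb (E′.sym r′mb))
      unique v e | rv′ , not-old | false with C.non-rep-has-smaller everywhere refl (not⁻ not-old)
      ... | u , _ , lt , ruv with R-via-a u v ruv
      ...   | inj₁ r′uv = ⊥-elim (≡true⇒≢false r′uv (C′.isRepᴿ-least everywhere rv′ u refl lt))
      ...   | inj₂ rva′ = ⊥-elim (≡true⇒≢false rva′ rva)

    numClasses-refine-suc : ∀ (a a′ : Fin n) → R a a′ ≡ true → R′ a a′ ≡ false →
      (∀ u v → R u v ≡ true → R′ u v ≡ true ⊎ (R′ u a ≡ true × R′ v a′ ≡ true) ⊎ (R′ u a′ ≡ true × R′ v a ≡ true)) →
      C′.numClasses everywhere ≡ suc (C.numClasses everywhere)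
    numClasses-refine-suc a a′ raa′ r′aa′≡false split = begin
      C′.numClasses everywhere
        ≡⟨ countB-split (isRepᴿ everywhere R′) (isRepᴿ everywhere R) (allFin n) ⟩
      countB (λ v → isRepᴿ everywhere R′ v ∧ isRepᴿ everywhere R v) (allFin n)
        + countB (λ v → isRepᴿ everywhere R′ v ∧ not (isRepᴿ everywhere R v)) (allFin n)
        ≡⟨ cong₂ _+_ (countB-cong (allFin n) old-reps) new-rep ⟩
      C.numClasses everywhere + 1
        ≡⟨ +-comm _ 1 ⟩
      suc (C.numClasses everywhere) ∎
      where
      open ≡-Reasoning
      old-reps : ∀ v → (isRepᴿ everywhere R′ v ∧ isRepᴿ everywhere R v) ≡ isRepᴿ everywhere R v
      old-reps v = bool-ext (λ e → proj₂ (∧⁻ {isRepᴿ everywhere R′ v} e)) (λ e → ∧⁺ (rep-refine v e) e)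
      class-a : ∀ v → R v a ≡ true → R′ v a ≡ true ⊎ R′ v a′ ≡ true
      class-a v e with split v a e
      ... | inj₁ x = inj₁ x
      ... | inj₂ (inj₁ (x , _)) = inj₁ x
      ... | inj₂ (inj₂ (x , _)) = inj₂ x
      R-via : ∀ c → R c a ≡ true → ∀ u v → R u v ≡ true → R′ u v ≡ true ⊎ R v c ≡ true
      R-via c rca u v e with split u v e
      ... | inj₁ x = inj₁ x
      ... | inj₂ (inj₁ (_ , x)) = inj₂ (E.trans (E.trans (R′⊆R x) (E.sym raa′)) (E.sym rca))
      ... | inj₂ (inj₂ (_ , x)) = inj₂ (E.trans (R′⊆R x) (E.sym rca))
      new-rep : countB (λ v → isRepᴿ everywhere R′ v ∧ not (isRepᴿ everywhere R v)) (allFin n) ≡ 1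
      new-rep with C.rep-exists everywhere a refl
      ... | m₀ , rm₀ , rm₀a with class-a m₀ rm₀a
      ...   | inj₁ r′m₀a = one-new-rep a a′ m₀ rm₀ r′m₀a r′aa′≡false raa′ class-a (R-via a E.refl)
      ...   | inj₂ r′m₀a′ = one-new-rep a′ a m₀ rm₀ r′m₀a′ r′a′a≡false (E.sym raa′)
                              (λ v e → Sum.swap (class-a v (E.trans e (E.sym raa′)))) (R-via a′ (E.sym raa′))
        where
        r′a′a≡false : R′ a′ a ≡ false
        r′a′a≡false = ≢true⇒≡false λ e → ≡true⇒≢false (E′.sym e) r′aa′≡false

least-ℕ : ∀ (Q : ℕ → Bool) k → Q k ≡ true → Σ ℕ λ m → Q m ≡ true × m ≤ k × (∀ j → j < m → Q j ≡ false)
least-ℕ Q zero qk = 0 , qk , z≤n , λ j ()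
least-ℕ Q (suc k) qk with Q 0 in q0
... | true  = 0 , q0 , z≤n , λ j ()
... | false with least-ℕ (λ j → Q (suc j)) k qk
...   | m , qm , m≤k , below = suc m , qm , s≤s m≤k , below′
  where
  below′ : ∀ j → j < suc m → Q j ≡ false
  below′ zero    _        = q0
  below′ (suc j) (s≤s lt) = below j lt

invol-injective : ∀ {A : Set} (f : A → A) → (∀ v → f (f v) ≡ v) → ∀ {a b} → f a ≡ f b → a ≡ b
invol-injective f f-invol {a} {b} e = trans (sym (f-invol a)) (trans (cong f e) (f-invol b))

module _ {A : Set} (f : A → A) where

  fold-step : ∀ k a → fold (f a) f k ≡ f (fold a f k)
  fold-step zero    a = refl
  fold-step (suc k) a = cong f (fold-step k a)

  fold-injective : (∀ {a b} → f a ≡ f b → a ≡ b) → ∀ k {a b} → fold a f k ≡ fold b f k → a ≡ b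
  fold-injective inj zero    e = e
  fold-injective inj (suc k) e = fold-injective inj k (inj e)

module _ {n : ℕ} (σ : Fin n → Fin n) (σ-injective : ∀ {a b} → σ a ≡ σ b → a ≡ b) where

  period : ∀ v → Σ ℕ λ L → 1 ≤ L × L ≤ n × fold v σ L ≡ v
  period v with pigeonhole (n<1+n n) (λ (i : Fin (suc n)) → fold v σ (toℕ i))
  ... | i , j , i<j , eq =
    toℕ j ∸ toℕ i , m<n⇒0<n∸m i<j , ≤-trans (m∸n≤m (toℕ j) (toℕ i)) (<⇒≤pred (FP.toℕ<n j)) ,
    sym (fold-injective σ σ-injective (toℕ i)
      (trans eq (trans (cong (fold v σ) (sym (m+[n∸m]≡n (<⇒≤ i<j)))) (fold-+ v σ (toℕ i)))))

  minimal-period : ∀ v → Σ ℕ λ L → 1 ≤ L × L ≤ n × fold v σ L ≡ v × (∀ k → 1 ≤ k → k < L → fold v σ k ≢ v)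
  minimal-period v with period v
  ... | zero  , () , _
  ... | suc P , _  , P<n , σᴾv≡v with least-ℕ (λ k → fold v σ (suc k) == v) P (==⁺ σᴾv≡v)
  ...   | L , σᴸv≡v , L≤P , below = suc L , s≤s z≤n , ≤-trans (s≤s L≤P) P<n , ==⁻ σᴸv≡v , minimal
    where
    minimal : ∀ k → 1 ≤ k → k < suc L → fold v σ k ≢ v
    minimal (suc k) _ (s≤s lt) e = ≡true⇒≢false (==⁺ e) (below k lt)

module _ {n : ℕ} where

  sameOrbit-isEquivalence : ∀ (gs : Gens n) → Invol gs → IsEquivalence (λ u v → sameOrbit gs u v ≡ true)
  sameOrbit-isEquivalence gs inv = record
    { refl  = sameOrbit-complete gs (Conn-refl _)
    ; sym   = λ e → sameOrbit-complete gs (Conn-sym inv (sameOrbit-sound gs e))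
    ; trans = λ e₁ e₂ → sameOrbit-complete gs (Conn-trans (sameOrbit-sound gs e₁) (sameOrbit-sound gs e₂))
    }

  Conn? : ∀ (gs : Gens n) u v → Dec (Conn gs u v)
  Conn? gs u v with sameOrbit gs u v in e
  ... | true  = yes (sameOrbit-sound gs e)
  ... | false = no λ c → ≡true⇒≢false (sameOrbit-complete gs c) e

  invol₂ : ∀ {f h : Fin n → Fin n} → (∀ v → f (f v) ≡ v) → (∀ v → h (h v) ≡ v) → Invol (f ∷ h ∷ [])
  invol₂ f-invol h-invol (here refl)         = f-invol
  invol₂ f-invol h-invol (there (here refl)) = h-invol

  preserves₂ : ∀ (L : Fin n → Bool) {f h : Fin n → Fin n} → (∀ x → L (f x) ≡ L x) → (∀ x → L (h x) ≡ L x) →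
    ∀ {k} → k ∈ (f ∷ h ∷ []) → ∀ x → L (k x) ≡ L x
  preserves₂ L L-f L-h (here refl)         = L-f
  preserves₂ L L-f L-h (there (here refl)) = L-h

  step₁ : ∀ {f h : Fin n → Fin n} t → Conn (f ∷ h ∷ []) (f t) t
  step₁ = Conn-step (here refl)

  step₂ : ∀ {f h : Fin n → Fin n} t → Conn (f ∷ h ∷ []) (h t) t
  step₂ = Conn-step (there (here refl))

  step₂-≡ : ∀ {f h : Fin n → Fin n} {t s} → s ≡ h t → Conn (f ∷ h ∷ []) s t
  step₂-≡ refl = step₂ _

  Conn₂-mono : ∀ {f h : Fin n → Fin n} {hs} → (∀ t → Conn hs (f t) t) → (∀ t → Conn hs (h t) t) →
    ∀ {u v} → Conn (f ∷ h ∷ []) u v → Conn hs u v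
  Conn₂-mono {f} {h} {hs} f-conn h-conn = Conn-mono steps
    where
    steps : ∀ {k} → k ∈ (f ∷ h ∷ []) → ∀ x → Conn hs (k x) x
    steps (here refl)         = f-conn
    steps (there (here refl)) = h-conn

  Conn₂-comm : ∀ {f h : Fin n → Fin n} {u v} → Conn (f ∷ h ∷ []) u v → Conn (h ∷ f ∷ []) u v
  Conn₂-comm = Conn₂-mono step₂ step₁

  Conn-preserves : ∀ (L : Fin n → Bool) gs → (∀ {f} → f ∈ gs → ∀ x → L (f x) ≡ L x) →
    ∀ {u v} → Conn gs u v → L u ≡ L v
  Conn-preserves L gs pres {v = v} = Conn-closed (λ x → L x ≡ L v) (λ m x e → trans (pres m x) e) refl

  ConnVia : Gens n → Fin n → Fin n → Fin n → Fin n → Set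
  ConnVia gs a a′ u v = Conn gs u v ⊎ (Conn gs u a × Conn gs v a′) ⊎ (Conn gs u a′ × Conn gs v a)

  Conn-via : ∀ {gs hs} → Invol hs → ∀ a a′ →
    (∀ {f} → f ∈ gs → ∀ t → Conn hs (f t) t ⊎ (Conn hs t a × Conn hs (f t) a′) ⊎ (Conn hs t a′ × Conn hs (f t) a)) →
    ∀ {u v} → Conn gs u v → ConnVia hs a a′ u v
  Conn-via {gs} {hs} inv a a′ steps {u} {v} = Conn-closed (λ t → ConnVia hs a a′ t v) extend (inj₁ (Conn-refl v))
    where
    sym′ : ∀ {x y} → Conn hs x y → Conn hs y x
    sym′ = Conn-sym inv
    _∙_ : ∀ {x y z} → Conn hs x y → Conn hs y z → Conn hs x z
    _∙_ = Conn-trans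
    move : ∀ {t t′} → Conn hs t′ t → ConnVia hs a a′ t v → ConnVia hs a a′ t′ v
    move e (inj₁ x)             = inj₁ (e ∙ x)
    move e (inj₂ (inj₁ (x , y))) = inj₂ (inj₁ (e ∙ x , y))
    move e (inj₂ (inj₂ (x , y))) = inj₂ (inj₂ (e ∙ x , y))
    cross : ∀ {t t′ b b′} → Conn hs t b → Conn hs t′ b′ →
      (b ≡ a × b′ ≡ a′) ⊎ (b ≡ a′ × b′ ≡ a) → ConnVia hs a a′ t v → ConnVia hs a a′ t′ v
    cross tb t′b′ (inj₁ (refl , refl)) (inj₁ x)              = inj₂ (inj₂ (t′b′ , sym′ x ∙ tb))
    cross tb t′b′ (inj₁ (refl , refl)) (inj₂ (inj₁ (x , y))) = inj₁ (t′b′ ∙ sym′ y)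
    cross tb t′b′ (inj₁ (refl , refl)) (inj₂ (inj₂ (x , y))) = inj₂ (inj₁ (t′b′ ∙ (sym′ x ∙ tb) , y ∙ (sym′ tb ∙ x)))
    cross tb t′b′ (inj₂ (refl , refl)) (inj₁ x)              = inj₂ (inj₁ (t′b′ , sym′ x ∙ tb))
    cross tb t′b′ (inj₂ (refl , refl)) (inj₂ (inj₁ (x , y))) = inj₂ (inj₂ (t′b′ ∙ (sym′ x ∙ tb) , y ∙ (sym′ tb ∙ x)))
    cross tb t′b′ (inj₂ (refl , refl)) (inj₂ (inj₂ (x , y))) = inj₁ (t′b′ ∙ sym′ y)
    extend : ∀ {f} → f ∈ gs → ∀ t → ConnVia hs a a′ t v → ConnVia hs a a′ (f t) v
    extend m t h with steps m t
    ... | inj₁ e                 = move e h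
    ... | inj₂ (inj₁ (e₁ , e₂)) = cross e₁ e₂ (inj₁ (refl , refl)) h
    ... | inj₂ (inj₂ (e₁ , e₂)) = cross e₁ e₂ (inj₂ (refl , refl)) h

  numOrbits-bridge : ∀ (gs gs′ : Gens n) → Invol gs → Invol gs′ → (∀ {u v} → Conn gs′ u v → Conn gs u v) →
    ∀ a a′ → Conn gs a a′ → ¬ Conn gs′ a a′ → (∀ {u v} → Conn gs u v → ConnVia gs′ a a′ u v) →
    numOrbits everywhere gs′ ≡ suc (numOrbits everywhere gs)
  numOrbits-bridge gs gs′ inv inv′ gs′⊆gs a a′ c ¬c′ via =
    Refinement.numClasses-refine-suc (sameOrbit-isEquivalence gs inv) (sameOrbit-isEquivalence gs′ inv′)
      (λ e → complete gs (gs′⊆gs (sound gs′ e))) a a′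
      (complete gs c) (≢true⇒≡false λ e → ¬c′ (sound gs′ e)) via′
    where
    complete = sameOrbit-complete
    sound = sameOrbit-sound
    via′ : ∀ u v → sameOrbit gs u v ≡ true →
      sameOrbit gs′ u v ≡ true ⊎ (sameOrbit gs′ u a ≡ true × sameOrbit gs′ v a′ ≡ true)
                               ⊎ (sameOrbit gs′ u a′ ≡ true × sameOrbit gs′ v a ≡ true)
    via′ u v e with via (sound gs e)
    ... | inj₁ x               = inj₁ (complete gs′ x)
    ... | inj₂ (inj₁ (x , y)) = inj₂ (inj₁ (complete gs′ x , complete gs′ y))
    ... | inj₂ (inj₂ (x , y)) = inj₂ (inj₂ (complete gs′ x , complete gs′ y))

  numOrbits-cong : ∀ (L : Fin n → Bool) (gs hs : Gens n) →
    (∀ {u v} → L u ≡ true → L v ≡ true → Conn gs u v → Conn hs u v) →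
    (∀ {u v} → L u ≡ true → L v ≡ true → Conn hs u v → Conn gs u v) →
    numOrbits L gs ≡ numOrbits L hs
  numOrbits-cong L gs hs gs⊆hs hs⊆gs = countB-cong (allFin n) same-reps
    where
    same-orbit : ∀ u v → L u ≡ true → L v ≡ true → sameOrbit gs u v ≡ sameOrbit hs u v
    same-orbit u v lu lv = bool-ext (λ e → sameOrbit-complete hs (gs⊆hs lu lv (sameOrbit-sound gs e)))
                                    (λ e → sameOrbit-complete gs (hs⊆gs lu lv (sameOrbit-sound hs e)))
    smaller : ∀ v → L v ≡ true → ∀ u →
      not (L u ∧ (toℕ u <ᵇ toℕ v) ∧ sameOrbit gs u v) ≡ not (L u ∧ (toℕ u <ᵇ toℕ v) ∧ sameOrbit hs u v)
    smaller v lv u with L u in lu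
    ... | false = refl
    ... | true rewrite same-orbit u v lu lv = refl
    same-reps : ∀ v → isRep L gs v ≡ isRep L hs v
    same-reps v with L v in lv
    ... | false = refl
    ... | true  = all-cong (allFin n) (smaller v lv)

  numOrbits-comm : ∀ L (f h : Fin n → Fin n) → numOrbits L (f ∷ h ∷ []) ≡ numOrbits L (h ∷ f ∷ [])
  numOrbits-comm L f h = numOrbits-cong L _ _ (λ _ _ → Conn₂-comm) (λ _ _ → Conn₂-comm)

  numOrbits-on : ∀ (L : Fin n → Bool) (f f′ h h′ : Fin n → Fin n) →
    (∀ x → L x ≡ true → L (f x) ≡ true) → (∀ x → L x ≡ true → L (h x) ≡ true) →
    (∀ x → L x ≡ true → f x ≡ f′ x) → (∀ x → L x ≡ true → h x ≡ h′ x) →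
    numOrbits L (f ∷ h ∷ []) ≡ numOrbits L (f′ ∷ h′ ∷ [])
  numOrbits-on L f f′ h h′ Lf Lh f≡f′ h≡h′ = numOrbits-cong L _ _
    (λ _ lv → Conn-mono-on (λ x → L x ≡ true) to lv) (λ _ lv → Conn-mono-on (λ x → L x ≡ true) from lv)
    where
    to : ∀ {k} → k ∈ (f ∷ h ∷ []) → ∀ x → L x ≡ true → L (k x) ≡ true × Conn (f′ ∷ h′ ∷ []) (k x) x
    to (here refl)         x lx = Lf x lx , subst (λ s → Conn _ s x) (sym (f≡f′ x lx)) (step₁ x)
    to (there (here refl)) x lx = Lh x lx , subst (λ s → Conn _ s x) (sym (h≡h′ x lx)) (step₂ x)
    from : ∀ {k} → k ∈ (f′ ∷ h′ ∷ []) → ∀ x → L x ≡ true → L (k x) ≡ true × Conn (f ∷ h ∷ []) (k x) x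
    from (here refl)         x lx =
      subst (λ s → L s ≡ true) (f≡f′ x lx) (Lf x lx) , subst (λ s → Conn _ s x) (f≡f′ x lx) (step₁ x)
    from (there (here refl)) x lx =
      subst (λ s → L s ≡ true) (h≡h′ x lx) (Lh x lx) , subst (λ s → Conn _ s x) (h≡h′ x lx) (step₂ x)

  numOrbits-partition : ∀ (L : Fin n → Bool) (gs : Gens n) → Invol gs → (∀ {f} → f ∈ gs → ∀ x → L (f x) ≡ L x) →
    numOrbits everywhere gs ≡ numOrbits L gs + numOrbits (λ v → not (L v)) gs
  numOrbits-partition L gs inv pres = Classes.numClasses-partition (sameOrbit-isEquivalence gs inv) L
    (λ e lv → trans (Conn-preserves L gs pres (sameOrbit-sound gs e)) lv)

  module PerfectMatching (L : Fin n → Bool) (f : Fin n → Fin n) (f-invol : ∀ v → f (f v) ≡ v)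
    (f-noloop : ∀ v → f v ≢ v) (L-pres : ∀ v → L (f v) ≡ L v) where

    numOrbits-matching : ∀ f′ → (∀ v → L v ≡ true → f′ v ≡ f v) → numOrbits L (f ∷ f′ ∷ []) ≡ numEdges L f
    numOrbits-matching f′ f′≡f = countB-cong (allFin n) rep-is-smaller-end
      where
      gs = f ∷ f′ ∷ []
      open Reps (sameOrbit gs)
      Edge : Fin n → Fin n → Set
      Edge v t = t ≡ v ⊎ t ≡ f v
      edge-closed : ∀ v → L v ≡ true → ∀ {h} → h ∈ gs → ∀ t → Edge v t → Edge v (h t)
      edge-closed v lv (here refl)         t (inj₁ refl) = inj₂ refl
      edge-closed v lv (here refl)         t (inj₂ refl) = inj₁ (f-invol v)
      edge-closed v lv (there (here refl)) t (inj₁ refl) = inj₂ (f′≡f v lv)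
      edge-closed v lv (there (here refl)) t (inj₂ refl) = inj₁ (trans (f′≡f (f v) (trans (L-pres v) lv)) (f-invol v))
      rep-is-smaller-end : ∀ v → isRep L gs v ≡ (L v ∧ (toℕ v <ᵇ toℕ (f v)))
      rep-is-smaller-end v = bool-ext to from
        where
        to : isRep L gs v ≡ true → (L v ∧ (toℕ v <ᵇ toℕ (f v))) ≡ true
        to r with <-cmp (toℕ v) (toℕ (f v))
        ... | tri< lt _ _ = ∧⁺ (isRepᴿ-live L r) (<ᵇ⁺ lt)
        ... | tri≈ _ eq _ = ⊥-elim (f-noloop v (sym (toℕ-injective eq)))
        ... | tri> _ _ gt = ⊥-elim (≡true⇒≢false (sameOrbit-complete gs (step₁ v))
                              (isRepᴿ-least L r (f v) (trans (L-pres v) (isRepᴿ-live L r)) gt))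
        from : (L v ∧ (toℕ v <ᵇ toℕ (f v))) ≡ true → isRep L gs v ≡ true
        from e with ∧⁻ {L v} e
        ... | lv , v<fv = isRepᴿ⁺ L lv least
          where
          least : ∀ u → L u ≡ true → toℕ u < toℕ v → sameOrbit gs u v ≡ false
          least u _ lt = ≢true⇒≡false λ ruv →
            case Conn-closed (Edge v) (edge-closed v lv) (inj₁ refl) (sameOrbit-sound gs ruv) of λ where
              (inj₁ refl) → ℕP.<-irrefl refl lt
              (inj₂ refl) → ℕP.<-asym lt (<ᵇ⁻ v<fv)

    numEdges-twice : numEdges L f + numEdges L f ≡ countB L (allFin n)
    numEdges-twice = sym (begin
      countB L (allFin n)
        ≡⟨ countB-split L (λ v → toℕ v <ᵇ toℕ (f v)) (allFin n) ⟩
      numEdges L f + countB (λ v → L v ∧ not (toℕ v <ᵇ toℕ (f v))) (allFin n)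
        ≡⟨ cong (numEdges L f ℕ.+_) (trans (countB-cong (allFin n) larger-end) (sym swap-ends)) ⟩
      numEdges L f + numEdges L f ∎)
      where
      open ≡-Reasoning
      larger-end : ∀ v → (L v ∧ not (toℕ v <ᵇ toℕ (f v))) ≡ (L v ∧ (toℕ (f v) <ᵇ toℕ v))
      larger-end v with <-cmp (toℕ v) (toℕ (f v))
      ... | tri< lt _ _ rewrite <ᵇ⁺ lt = cong (L v ∧_) (sym (≢true⇒≡false λ e → ℕP.<-asym lt (<ᵇ⁻ e)))
      ... | tri≈ _ eq _ = ⊥-elim (f-noloop v (sym (toℕ-injective eq)))
      ... | tri> _ _ gt rewrite <ᵇ⁺ gt = cong (λ b → L v ∧ not b) (≢true⇒≡false λ e → ℕP.<-asym gt (<ᵇ⁻ e))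
      swap-ends : numEdges L f ≡ countB (λ v → L v ∧ (toℕ (f v) <ᵇ toℕ v)) (allFin n)
      swap-ends = countB-≡-bijection _ _ (λ x y → y ≡ f x)
        (λ x e → f x , subst (λ z → (L (f x) ∧ (toℕ z <ᵇ toℕ (f x))) ≡ true) (sym (f-invol x))
                         (subst (λ z → (z ∧ _) ≡ true) (sym (L-pres x)) e) , refl)
        (λ y e → f y , subst (λ z → (z ∧ _) ≡ true) (sym (L-pres y))
                         (subst (λ z → (L y ∧ (toℕ (f y) <ᵇ toℕ z)) ≡ true) (sym (f-invol y)) e) , sym (f-invol y))
        (λ x x′ y _ _ e₁ e₂ → invol-injective f f-invol (trans (sym e₁) e₂))
        (λ x y y′ _ _ e₁ e₂ → trans e₁ (sym e₂))

  numEdges-independent : ∀ (L : Fin n → Bool) (f h : Fin n → Fin n) →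
    (∀ v → f (f v) ≡ v) → (∀ v → f v ≢ v) → (∀ v → L (f v) ≡ L v) →
    (∀ v → h (h v) ≡ v) → (∀ v → h v ≢ v) → (∀ v → L (h v) ≡ L v) →
    numEdges L f ≡ numEdges L h
  numEdges-independent L f h f-invol f-noloop L-f h-invol h-noloop L-h = begin
    numEdges L f                           ≡⟨ n≡⌊n+n/2⌋ _ ⟩
    ⌊ numEdges L f + numEdges L f /2⌋      ≡⟨ cong ⌊_/2⌋ (trans (PerfectMatching.numEdges-twice L f f-invol f-noloop L-f)
                                                          (sym (PerfectMatching.numEdges-twice L h h-invol h-noloop L-h))) ⟩
    ⌊ numEdges L h + numEdges L h /2⌋      ≡⟨ n≡⌊n+n/2⌋ _ ⟨
    numEdges L h                           ∎
    where open ≡-Reasoning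

  numEdges-partition : ∀ (L : Fin n → Bool) (f : Fin n → Fin n) →
    numEdges everywhere f ≡ numEdges L f + numEdges (λ v → not (L v)) f
  numEdges-partition L f = trans (countB-split (λ v → toℕ v <ᵇ toℕ (f v)) L (allFin n))
    (cong₂ _+_ (countB-cong (allFin n) (λ v → ∧-comm _ (L v))) (countB-cong (allFin n) (λ v → ∧-comm _ (not (L v)))))

two-colours : ∀ {a b d : Bool} → a ≢ b → b ≢ d → a ≡ d
two-colours {false} {false}         a≢b _   = ⊥-elim (a≢b refl)
two-colours {false} {true}  {false} _   _   = refl
two-colours {false} {true}  {true}  _   b≢d = ⊥-elim (b≢d refl)
two-colours {true}  {false} {false} _   b≢d = ⊥-elim (b≢d refl)
two-colours {true}  {false} {true}  _   _   = refl
two-colours {true}  {true}          a≢b _   = ⊥-elim (a≢b refl)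

if-true : ∀ {A : Set} {b} {u v : A} → b ≡ true → (if b then u else v) ≡ u
if-true refl = refl

if-false : ∀ {A : Set} {b} {u v : A} → b ≡ false → (if b then u else v) ≡ v
if-false refl = refl

switch : ∀ {n} → (Fin n → Fin n) → Fin n → Fin n → Fin n → Fin n
switch q x y v = if v == x then y else if v == y then x else if v == q x then q y else if v == q y then q x else q v

module Switching {n : ℕ} (p q : Fin n → Fin n) (p-invol : ∀ v → p (p v) ≡ v) (q-invol : ∀ v → q (q v) ≡ v)
  (c : Fin n → Bool) (p-bip : ∀ v → c (p v) ≢ c v) (q-bip : ∀ v → c (q v) ≢ c v) where

  G : Gens n
  G = p ∷ q ∷ []

  G-invol : Invol G
  G-invol = invol₂ p-invol q-invol

  π : Fin n → Fin n
  π t = q (p t)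

  π-injective : ∀ {a b} → π a ≡ π b → a ≡ b
  π-injective = invol-injective p p-invol ∘′ invol-injective q q-invol

  c-fold-π : ∀ k t → c (fold t π k) ≡ c t
  c-fold-π zero    t = refl
  c-fold-π (suc k) t = trans (two-colours (q-bip (p _)) (p-bip _)) (c-fold-π k t)

  module Switch (x y : Fin n) (x≢y : x ≢ y) (x≢w : x ≢ q y) (y≢z : y ≢ q x) (cx≢cy : c x ≢ c y) where

    z w : Fin n
    z = q x
    w = q y

    q′ : Fin n → Fin n
    q′ = switch q x y

    G′ : Gens n
    G′ = p ∷ q′ ∷ []

    x≢z : x ≢ z
    x≢z e = q-bip x (cong c (sym e))
    y≢w : y ≢ w
    y≢w e = q-bip y (cong c (sym e))
    z≢w : z ≢ w
    z≢w e = x≢y (invol-injective q q-invol e)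

    cw≡cx : c w ≡ c x
    cw≡cx = two-colours (q-bip y) (λ e → cx≢cy (sym e))

    q′x : q′ x ≡ y
    q′x = if-true (==-refl x)
    q′y : q′ y ≡ x
    q′y = trans (if-false (==-false (x≢y ∘′ sym))) (if-true (==-refl y))
    q′z : q′ z ≡ w
    q′z = trans (if-false (==-false (x≢z ∘′ sym))) (trans (if-false (==-false (y≢z ∘′ sym))) (if-true (==-refl z)))
    q′w : q′ w ≡ z
    q′w = trans (if-false (==-false (x≢w ∘′ sym))) (trans (if-false (==-false (y≢w ∘′ sym)))
            (trans (if-false (==-false (z≢w ∘′ sym))) (if-true (==-refl w))))
    q′-elsewhere : ∀ t → t ≢ x → t ≢ y → t ≢ z → t ≢ w → q′ t ≡ q t
    q′-elsewhere t t≢x t≢y t≢z t≢w = trans (if-false (==-false t≢x)) (trans (if-false (==-false t≢y))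
                                      (trans (if-false (==-false t≢z)) (if-false (==-false t≢w))))

    data Position (t : Fin n) : Set where
      at-x : t ≡ x → Position t
      at-y : t ≡ y → Position t
      at-z : t ≡ z → Position t
      at-w : t ≡ w → Position t
      elsewhere : t ≢ x → t ≢ y → t ≢ z → t ≢ w → Position t

    position : ∀ t → Position t
    position t with t F.≟ x | t F.≟ y | t F.≟ z | t F.≟ w
    ... | yes e | _     | _     | _     = at-x e
    ... | no _  | yes e | _     | _     = at-y e
    ... | no _  | no _  | yes e | _     = at-z e
    ... | no _  | no _  | no _  | yes e = at-w e
    ... | no a  | no b  | no d  | no e  = elsewhere a b d e

    q′-invol : ∀ t → q′ (q′ t) ≡ t
    q′-invol t with position t
    ... | at-x refl = trans (cong q′ q′x) q′y
    ... | at-y refl = trans (cong q′ q′y) q′x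
    ... | at-z refl = trans (cong q′ q′z) q′w
    ... | at-w refl = trans (cong q′ q′w) q′z
    ... | elsewhere a b d e = trans (cong q′ (q′-elsewhere t a b d e))
           (trans (q′-elsewhere (q t) (λ h → d (trans (sym (q-invol t)) (cong q h)))
                                      (λ h → e (trans (sym (q-invol t)) (cong q h)))
                                      (a ∘′ invol-injective q q-invol) (b ∘′ invol-injective q q-invol))
                  (q-invol t))

    q′-bip : ∀ t → c (q′ t) ≢ c t
    q′-bip t with position t
    ... | at-x refl = λ h → cx≢cy (sym (trans (sym (cong c q′x)) h))
    ... | at-y refl = λ h → cx≢cy (trans (sym (cong c q′y)) h)
    ... | at-z refl = λ h → q-bip x (trans (sym (trans (cong c (sym q′z)) h)) cw≡cx)
    ... | at-w refl = λ h → q-bip x (trans (trans (cong c (sym q′w)) h) cw≡cx)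
    ... | elsewhere a b d e = λ h → q-bip t (trans (cong c (sym (q′-elsewhere t a b d e))) h)

    G′-invol : Invol G′
    G′-invol = invol₂ p-invol q′-invol

    walk : ℕ → Fin n
    walk k = fold x π k

    private
      period-x = minimal-period π π-injective x

    L : ℕ
    L = proj₁ period-x
    1≤L : 1 ≤ L
    1≤L = proj₁ (proj₂ period-x)
    walk-L : walk L ≡ x
    walk-L = proj₁ (proj₂ (proj₂ (proj₂ period-x)))
    walk-minimal : ∀ k → 1 ≤ k → k < L → walk k ≢ x
    walk-minimal = proj₂ (proj₂ (proj₂ (proj₂ period-x)))

    L′ : ℕ
    L′ = L ∸ 1
    L≡1+L′ : L ≡ suc L′
    L≡1+L′ = sym (m+[n∸m]≡n 1≤L)

    p-walk-L′ : p (walk L′) ≡ z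
    p-walk-L′ = trans (sym (q-invol _)) (cong q (trans (cong (fold x π) (sym L≡1+L′)) walk-L))

    p-walk≢z : ∀ k → k < L′ → p (walk k) ≢ z
    p-walk≢z k lt e = walk-minimal (suc k) (s≤s z≤n) (subst (suc k <_) (sym L≡1+L′) (s≤s lt)) (trans (cong q e) (q-invol x))

    c-walk : ∀ k → c (walk k) ≡ c x
    c-walk k = c-fold-π k x
    c-p-walk : ∀ k → c (p (walk k)) ≢ c x
    c-p-walk k e = p-bip (walk k) (trans e (sym (c-walk k)))

    Conn-walk : ∀ k → Conn G (walk k) x
    Conn-walk zero    = Conn-refl x
    Conn-walk (suc k) = Conn-trans (step₂ (p (walk k))) (Conn-trans (step₁ (walk k)) (Conn-walk k))

    Conn-p-walk : ∀ k → Conn G (p (walk k)) x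
    Conn-p-walk k = Conn-trans (step₁ (walk k)) (Conn-walk k)

    walk-distinct : ∀ a b → a < b → b < L → walk a ≢ walk b
    walk-distinct a b a<b b<L e = walk-minimal (b ∸ a) (m<n⇒0<n∸m a<b) (≤-<-trans (m∸n≤m b a) b<L)
      (sym (fold-injective π π-injective a
        (trans e (trans (cong (fold x π) (sym (m+[n∸m]≡n (<⇒≤ a<b)))) (fold-+ x π a)))))

    -- The p–q cycle through x misses y and w, so the switch only removes its edge {z, x}.
    z-reaches-x : ¬ Conn G y x → Conn G′ z x
    z-reaches-x y≁x = subst (λ t → Conn G′ t x) p-walk-L′ (Conn-trans (step₁ (walk L′)) (walk-Conn′ L′ ≤-refl))
      where
      walk-Conn′ : ∀ k → k ≤ L′ → Conn G′ (walk k) x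
      walk-Conn′ zero    _  = Conn-refl x
      walk-Conn′ (suc k) le =
        Conn-trans (step₂-≡ (sym q′a≡qa)) (Conn-trans (step₁ (walk k)) (walk-Conn′ k (<⇒≤ le)))
        where
        a = p (walk k)
        q′a≡qa : q′ a ≡ q a
        q′a≡qa = q′-elsewhere a (λ e → c-p-walk k (cong c e)) (λ e → y≁x (subst (λ t → Conn G t x) e (Conn-p-walk k)))
                   (p-walk≢z k le) (λ e → c-p-walk k (trans (cong c e) cw≡cx))

    OnCycle : Fin n → Set
    OnCycle t = Σ ℕ λ k → k < L × (t ≡ walk k ⊎ t ≡ p (walk k))

    OnCycle-closed : ∀ {f} → f ∈ G → ∀ t → OnCycle t → OnCycle (f t)
    OnCycle-closed (here refl) t (k , lt , inj₁ e) = k , lt , inj₂ (cong p e)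
    OnCycle-closed (here refl) t (k , lt , inj₂ e) = k , lt , inj₁ (trans (cong p e) (p-invol _))
    OnCycle-closed (there (here refl)) t (zero , lt , inj₁ e) =
      L′ , subst (L′ <_) (sym L≡1+L′) ≤-refl , inj₂ (trans (cong q e) (sym p-walk-L′))
    OnCycle-closed (there (here refl)) t (suc k , lt , inj₁ e) =
      k , <-trans (n<1+n k) lt , inj₂ (trans (cong q e) (q-invol _))
    OnCycle-closed (there (here refl)) t (k , lt , inj₂ e) with m≤n⇒m<n∨m≡n lt
    ... | inj₁ lt′ = suc k , lt′ , inj₁ (cong q e)
    ... | inj₂ eq  = zero , <-≤-trans (s≤s z≤n) 1≤L , inj₁ (trans (cong q e) (trans (cong (fold x π) eq) walk-L))

    -- Bipartiteness enters here: c y ≢ c x, so y lies at an odd position p (walk j) of the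
    -- p–q cycle through x, strictly before z = p (walk L′).
    first-visit-of-y : Conn G y x →
      Σ ℕ λ j → j < L′ × p (walk j) ≡ y × (∀ i → i < j → (p (walk i) == y) ≡ false)
    first-visit-of-y y∼x with Conn-closed OnCycle OnCycle-closed (0 , 1≤L , inj₁ refl) y∼x
    ... | k , _   , inj₁ e = ⊥-elim (cx≢cy (sym (trans (cong c e) (c-walk k))))
    ... | k , k<L , inj₂ e with least-ℕ (λ j → p (walk j) == y) k (==⁺ (sym e))
    ...   | j , pj≡y , j≤k , before = j , j<L′ , ==⁻ pj≡y , before
      where
      j<L′ : j < L′
      j<L′ with m≤n⇒m<n∨m≡n (subst (j <_) L≡1+L′ (≤-<-trans j≤k k<L))
      ... | inj₁ (s≤s lt) = lt
      ... | inj₂ eq = ⊥-elim (y≢z (trans (sym (==⁻ pj≡y)) (trans (cong (p ∘′ walk) (ℕP.suc-injective eq)) p-walk-L′)))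

    -- After the switch, q′ y = x closes the arc x, p x, …, p (walk j) = y into a cycle
    -- that misses z.
    z-cut-from-x : Conn G y x → ¬ Conn G′ z x
    z-cut-from-x y∼x z∼′x with first-visit-of-y y∼x
    ... | j , j<L′ , pj≡y , before = not-on-arc (Conn-closed OnArc OnArc-closed (0 , z≤n , inj₁ refl) z∼′x)
      where
      OnArc : Fin n → Set
      OnArc t = Σ ℕ λ k → k ≤ j × (t ≡ walk k ⊎ t ≡ p (walk k))
      j<L : j < L
      j<L = <-trans j<L′ (subst (L′ <_) (sym L≡1+L′) ≤-refl)
      OnArc-closed : ∀ {f} → f ∈ G′ → ∀ t → OnArc t → OnArc (f t)
      OnArc-closed (here refl) t (k , le , inj₁ e) = k , le , inj₂ (cong p e)
      OnArc-closed (here refl) t (k , le , inj₂ e) = k , le , inj₁ (trans (cong p e) (p-invol _))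
      OnArc-closed (there (here refl)) t (zero , le , inj₁ refl) = j , ≤-refl , inj₂ (trans q′x (sym pj≡y))
      OnArc-closed (there (here refl)) t (suc k , le , inj₁ refl) = k , <⇒≤ le , inj₂ (trans q′≡q (q-invol _))
        where
        q′≡q : q′ (walk (suc k)) ≡ q (walk (suc k))
        q′≡q = q′-elsewhere _ (walk-minimal (suc k) (s≤s z≤n) (≤-<-trans le j<L))
                 (λ e → cx≢cy (trans (sym (c-walk (suc k))) (cong c e)))
                 (λ e → q-bip x (trans (sym (cong c e)) (c-walk (suc k))))
                 (λ e → walk-distinct (suc k) (suc j) (s≤s le) (subst (suc j <_) (sym L≡1+L′) (s≤s j<L′))
                          (trans e (cong q (sym pj≡y))))
      OnArc-closed (there (here refl)) t (k , le , inj₂ refl) with m≤n⇒m<n∨m≡n le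
      ... | inj₂ refl = zero , z≤n , inj₁ (trans (cong q′ pj≡y) q′y)
      ... | inj₁ lt   = suc k , lt , inj₁ q′≡q
        where
        q′≡q : q′ (p (walk k)) ≡ walk (suc k)
        q′≡q = q′-elsewhere _ (λ e → c-p-walk k (cong c e))
                 (λ e → ≡true⇒≢false (==⁺ e) (before k lt))
                 (p-walk≢z k (<-trans lt j<L′)) (λ e → c-p-walk k (trans (cong c e) cw≡cx))
      not-on-arc : ¬ OnArc z
      not-on-arc (k , le , inj₁ e) = q-bip x (trans (cong c e) (c-walk k))
      not-on-arc (k , le , inj₂ e) = p-walk≢z k (≤-<-trans le j<L′) (sym e)

  module SwitchCount (x y : Fin n) (x≢y : x ≢ y) (x≢w : x ≢ q y) (y≢z : y ≢ q x) (cx≢cy : c x ≢ c y) where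
    open Switch x y x≢y x≢w y≢z cx≢cy public
    private
      module Y = Switch y x (x≢y ∘′ sym) y≢z x≢w (cx≢cy ∘′ sym)

    switch-comm : ∀ t → switch q y x t ≡ q′ t
    switch-comm t with position t
    ... | at-x refl = trans Y.q′y (sym q′x)
    ... | at-y refl = trans Y.q′x (sym q′y)
    ... | at-z refl = trans Y.q′w (sym q′z)
    ... | at-w refl = trans Y.q′z (sym q′w)
    ... | elsewhere a b d e = trans (Y.q′-elsewhere t b a e d) (sym (q′-elsewhere t a b d e))

    w-reaches-y : ¬ Conn G y x → Conn G′ w y
    w-reaches-y y≁x = Conn₂-mono {h = switch q y x} step₁ (λ t → step₂-≡ (switch-comm t))
                        (Y.z-reaches-x (y≁x ∘′ Conn-sym G-invol))

    numOrbits-switch-split : Conn G y x → numOrbits everywhere G′ ≡ suc (numOrbits everywhere G)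
    numOrbits-switch-split y∼x = numOrbits-bridge G G′ G-invol G′-invol (Conn₂-mono step₁ q′-step) x z
      (Conn-sym G-invol (step₂ x)) (z-cut-from-x y∼x ∘′ Conn-sym G′-invol) (Conn-via G′-invol x z old-step)
      where
      z∼w : Conn G z w
      z∼w = Conn-trans (step₂ x) (Conn-trans (Conn-sym G-invol y∼x) (Conn-sym G-invol (step₂ y)))
      q′-step : ∀ t → Conn G (q′ t) t
      q′-step t with position t
      ... | at-x refl = subst (λ s → Conn G s x) (sym q′x) y∼x
      ... | at-y refl = subst (λ s → Conn G s y) (sym q′y) (Conn-sym G-invol y∼x)
      ... | at-z refl = subst (λ s → Conn G s z) (sym q′z) (Conn-sym G-invol z∼w)
      ... | at-w refl = subst (λ s → Conn G s w) (sym q′w) z∼w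
      ... | elsewhere a b d e = step₂-≡ (q′-elsewhere t a b d e)
      old-step : ∀ {f} → f ∈ G → ∀ t → Conn G′ (f t) t ⊎ (Conn G′ t x × Conn G′ (f t) z) ⊎ (Conn G′ t z × Conn G′ (f t) x)
      old-step (here refl) t = inj₁ (step₁ t)
      old-step (there (here refl)) t with position t
      ... | at-x refl = inj₂ (inj₁ (Conn-refl x , Conn-refl z))
      ... | at-z refl = inj₂ (inj₂ (Conn-refl z , subst (λ s → Conn G′ s x) (sym (q-invol x)) (Conn-refl x)))
      ... | at-y refl = inj₂ (inj₁ (Conn-sym G′-invol (step₂-≡ (sym q′y)) , Conn-sym G′-invol (step₂-≡ (sym q′w))))
      ... | at-w refl = inj₂ (inj₂ (Conn-sym G′-invol (step₂-≡ (sym q′w)) ,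
                                    subst (λ s → Conn G′ s x) (sym (q-invol y)) (Conn-sym G′-invol (step₂-≡ (sym q′y)))))
      ... | elsewhere a b d e = inj₁ (step₂-≡ (sym (q′-elsewhere t a b d e)))

    numOrbits-switch-merge : ¬ Conn G y x → suc (numOrbits everywhere G′) ≡ numOrbits everywhere G
    numOrbits-switch-merge y≁x = sym (numOrbits-bridge G′ G G′-invol G-invol (Conn₂-mono step₁ q-step) x y
      (Conn-sym G′-invol (step₂-≡ (sym q′x))) (y≁x ∘′ Conn-sym G-invol) (Conn-via G-invol x y new-step))
      where
      q-step : ∀ t → Conn G′ (q t) t
      q-step t with position t
      ... | at-x refl = z-reaches-x y≁x
      ... | at-y refl = w-reaches-y y≁x
      ... | at-z refl = subst (λ s → Conn G′ s z) (sym (q-invol x)) (Conn-sym G′-invol (z-reaches-x y≁x))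
      ... | at-w refl = subst (λ s → Conn G′ s w) (sym (q-invol y)) (Conn-sym G′-invol (w-reaches-y y≁x))
      ... | elsewhere a b d e = step₂-≡ (sym (q′-elsewhere t a b d e))
      new-step : ∀ {f} → f ∈ G′ → ∀ t → Conn G (f t) t ⊎ (Conn G t x × Conn G (f t) y) ⊎ (Conn G t y × Conn G (f t) x)
      new-step (here refl) t = inj₁ (step₁ t)
      new-step (there (here refl)) t with position t
      ... | at-x refl = inj₂ (inj₁ (Conn-refl x , subst (λ s → Conn G s y) (sym q′x) (Conn-refl y)))
      ... | at-y refl = inj₂ (inj₂ (Conn-refl y , subst (λ s → Conn G s x) (sym q′y) (Conn-refl x)))
      ... | at-z refl = inj₂ (inj₁ (step₂ x , subst (λ s → Conn G s y) (sym q′z) (step₂ y)))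
      ... | at-w refl = inj₂ (inj₂ (step₂ y , subst (λ s → Conn G s x) (sym q′w) (step₂ x)))
      ... | elsewhere a b d e = inj₁ (step₂-≡ (q′-elsewhere t a b d e))

module Triangle {n : ℕ} (p q : Fin n → Fin n) (p-invol : ∀ v → p (p v) ≡ v) (q-invol : ∀ v → q (q v) ≡ v)
  (c : Fin n → Bool) (p-bip : ∀ v → c (p v) ≢ c v) (q-bip : ∀ v → c (q v) ≢ c v) where

  O : (Fin n → Fin n) → (Fin n → Fin n) → ℕ
  O f h = numOrbits everywhere (f ∷ h ∷ [])

  N : ℕ
  N = numEdges everywhere p

  p-noloop : ∀ v → p v ≢ v
  p-noloop v e = p-bip v (cong c e)

  disagreement : (Fin n → Fin n) → ℕ
  disagreement t = countB (λ v → not (t v == p v)) (allFin n)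

  Defect : (Fin n → Fin n) → Set
  Defect t = Σ ℕ λ m → O q t + N ≡ O p q + O p t + 2 * m

  defect-at-p : ∀ t → (∀ v → t v ≡ p v) → Defect t
  defect-at-p t t≡p = 0 , (begin
    O q t + N              ≡⟨ cong (ℕ._+ N) qt≡pq ⟩
    O p q + N              ≡⟨ cong (O p q ℕ.+_) pt≡N ⟨
    O p q + O p t          ≡⟨ +-identityʳ _ ⟨
    O p q + O p t + 2 * 0  ∎)
    where
    open ≡-Reasoning
    qt≡pq : O q t ≡ O p q
    qt≡pq = trans (numOrbits-on everywhere q q t p (λ _ _ → refl) (λ _ _ → refl) (λ _ _ → refl) (λ v _ → t≡p v))
                  (numOrbits-comm everywhere q p)
    pt≡N : O p t ≡ N
    pt≡N = PerfectMatching.numOrbits-matching everywhere p p-invol p-noloop (λ _ → refl) t (λ v _ → t≡p v)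

  private
    one-more-cycle : ∀ a b m → a + suc b + 2 * m ≡ suc (a + b + 2 * m)
    one-more-cycle = solve-∀ℕ
    two-more : ∀ a m → suc (suc (a + 2 * m)) ≡ a + 2 * suc m
    two-more = solve-∀ℕ

  module Step (t : Fin n → Fin n) (t-invol : ∀ v → t (t v) ≡ v) (t-bip : ∀ v → c (t v) ≢ c v)
    (x : Fin n) (tx≢px : t x ≢ p x) where

    private
      x≢px : x ≢ p x
      x≢px e = p-noloop x (sym e)
      x≢tpx : x ≢ t (p x)
      x≢tpx e = tx≢px (trans (cong t e) (t-invol (p x)))
      cx≢cpx : c x ≢ c (p x)
      cx≢cpx e = p-bip x (sym e)

    module P = Switching.SwitchCount p t p-invol t-invol c p-bip t-bip x (p x) x≢px x≢tpx (tx≢px ∘′ sym) cx≢cpx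
    module Q = Switching.SwitchCount q t q-invol t-invol c q-bip t-bip x (p x) x≢px x≢tpx (tx≢px ∘′ sym) cx≢cpx

    t′ : Fin n → Fin n
    t′ = switch t x (p x)

    closer : disagreement t′ < disagreement t
    closer = countB-< _ _ (∈-allFin x) still-differs (not⁺ (==-false tx≢px)) (cong not (==⁺ P.q′x))
      where
      still-differs : ∀ v → not (t′ v == p v) ≡ true → not (t v == p v) ≡ true
      still-differs v d with P.position v
      ... | P.at-x refl = ⊥-elim (≡true⇒≢false (==⁺ P.q′x) (not⁻ d))
      ... | P.at-y refl = ⊥-elim (≡true⇒≢false (==⁺ (trans P.q′y (sym (p-invol x)))) (not⁻ d))
      ... | P.at-z refl = not⁺ (==-false λ e → tx≢px (sym (trans (cong p (trans (sym (t-invol x)) e)) (p-invol (t x)))))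
      ... | P.at-w refl = not⁺ (==-false λ e →
              x≢tpx (trans (sym (p-invol x)) (trans (cong p (trans (sym (t-invol (p x))) e)) (p-invol _))))
      ... | P.elsewhere v≢x v≢y v≢z v≢w = subst (λ s → not (s == p v) ≡ true) (P.q′-elsewhere v v≢x v≢y v≢z v≢w) d

    -- The switch adds one p–t cycle and splits or merges one q–t cycle, so the defect
    -- stays the same or drops by 2.
    defect-from-switch : Defect t′ → Defect t
    defect-from-switch (m , ih) with Conn? (q ∷ t ∷ []) (p x) x
    ... | yes px∼x = m , ℕP.suc-injective (begin
      suc (O q t) + N               ≡⟨ cong (ℕ._+ N) (Q.numOrbits-switch-split px∼x) ⟨
      O q t′ + N                    ≡⟨ ih ⟩
      O p q + O p t′ + 2 * m        ≡⟨ cong (λ k → O p q + k + 2 * m) (P.numOrbits-switch-split (step₁ x)) ⟩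
      O p q + suc (O p t) + 2 * m   ≡⟨ one-more-cycle (O p q) (O p t) m ⟩
      suc (O p q + O p t + 2 * m)   ∎)
      where open ≡-Reasoning
    ... | no px≁x = suc m , (begin
      O q t + N                           ≡⟨ cong (ℕ._+ N) (Q.numOrbits-switch-merge px≁x) ⟨
      suc (O q t′ + N)                    ≡⟨ cong suc ih ⟩
      suc (O p q + O p t′ + 2 * m)        ≡⟨ cong (λ k → suc (O p q + k + 2 * m)) (P.numOrbits-switch-split (step₁ x)) ⟩
      suc (O p q + suc (O p t) + 2 * m)   ≡⟨ cong suc (one-more-cycle (O p q) (O p t) m) ⟩
      suc (suc (O p q + O p t + 2 * m))   ≡⟨ two-more (O p q + O p t) m ⟩
      O p q + O p t + 2 * suc m           ∎)
      where open ≡-Reasoning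

  defect-by-distance : ∀ k t → disagreement t ≤ k → (∀ v → t (t v) ≡ v) → (∀ v → c (t v) ≢ c v) → Defect t
  defect-by-distance k t d≤k t-invol t-bip with any? (λ x → ¬? (t x F.≟ p x))
  ... | no agree = defect-at-p t (λ v → decidable-stable (t v F.≟ p v) (λ ne → agree (v , ne)))
  defect-by-distance zero t d≤k t-invol t-bip | yes (x , tx≢px) =
    ⊥-elim (ℕP.n≮0 (<-≤-trans (Step.closer t t-invol t-bip x tx≢px) d≤k))
  defect-by-distance (suc k) t d≤k t-invol t-bip | yes (x , tx≢px) = S.defect-from-switch
    (defect-by-distance k S.t′ (ℕP.≤-pred (<-≤-trans S.closer d≤k)) S.P.q′-invol S.P.q′-bip)
    where module S = Step t t-invol t-bip x tx≢px

  triangle : ∀ t → (∀ v → t (t v) ≡ v) → (∀ v → c (t v) ≢ c v) → Defect t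
  triangle t = defect-by-distance (disagreement t) t ≤-refl

module AvoidingOrbits {N : ℕ} (A : Fin N → Bool) (f t₁ t₂ : Fin N → Fin N) (f-invol : ∀ v → f (f v) ≡ v)
  (t₁-invol : ∀ v → t₁ (t₁ v) ≡ v) (t₂-invol : ∀ v → t₂ (t₂ v) ≡ v) (t₁≡t₂ : ∀ v → A v ≡ false → t₁ v ≡ t₂ v) where

  G₁ G₂ : Gens N
  G₁ = f ∷ t₁ ∷ []
  G₂ = f ∷ t₂ ∷ []

  avoids : Gens N → Fin N → Bool
  avoids G = Reps.avoids (sameOrbit G) A

  avoids-sound : ∀ G → Invol G → ∀ {v u} → avoids G v ≡ true → Conn G u v → A u ≡ false
  avoids-sound G inv {v} {u} av c = ≢true⇒≡false λ Au →
    ≡true⇒≢false (∧⁺ (sameOrbit-complete G (Conn-sym inv c)) Au) (not⁻ (all⁻ _ av (∈-allFin u)))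

  avoids-complete : ∀ G {v} → (∀ u → Conn G v u → A u ≡ false) → avoids G v ≡ true
  avoids-complete G {v} off = all⁺ _ (allFin N) λ u _ → not⁺ (≢true⇒≡false λ e →
    ≡true⇒≢false (proj₂ (∧⁻ {sameOrbit G v u} e)) (off u (sameOrbit-sound G (proj₁ (∧⁻ e)))))

  module Transfer (Ga Gb : Gens N) (inv-a : Invol Ga) (inv-b : Invol Gb)
    (steps : ∀ {k} → k ∈ Gb → ∀ x → A x ≡ false → Conn Ga (k x) x) where

    Conn-transfer : ∀ {v} → avoids Ga v ≡ true → ∀ {u} → Conn Gb u v → Conn Ga u v
    Conn-transfer {v} av = Conn-mono-on (λ x → Conn Ga x v)
      (λ m x cx → Conn-trans (steps m x (avoids-sound Ga inv-a av cx)) cx , steps m x (avoids-sound Ga inv-a av cx))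
      (Conn-refl v)

    avoids-transfer : ∀ {v} → avoids Ga v ≡ true → avoids Gb v ≡ true
    avoids-transfer av = avoids-complete Gb λ u c → avoids-sound Ga inv-a av (Conn-transfer av (Conn-sym inv-b c))

  private
    steps₂₁ : ∀ {k} → k ∈ G₂ → ∀ x → A x ≡ false → Conn G₁ (k x) x
    steps₂₁ (here refl)         x _  = step₁ x
    steps₂₁ (there (here refl)) x Ax = step₂-≡ (sym (t₁≡t₂ x Ax))
    steps₁₂ : ∀ {k} → k ∈ G₁ → ∀ x → A x ≡ false → Conn G₂ (k x) x
    steps₁₂ (here refl)         x _  = step₁ x
    steps₁₂ (there (here refl)) x Ax = step₂-≡ (t₁≡t₂ x Ax)
    module T₁ = Transfer G₁ G₂ (invol₂ f-invol t₁-invol) (invol₂ f-invol t₂-invol) steps₂₁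
    module T₂ = Transfer G₂ G₁ (invol₂ f-invol t₂-invol) (invol₂ f-invol t₁-invol) steps₁₂

  avoiding-rep-cong : ∀ v → (isRep everywhere G₁ v ∧ avoids G₁ v) ≡ (isRep everywhere G₂ v ∧ avoids G₂ v)
  avoiding-rep-cong v with avoids G₁ v in av₁ | avoids G₂ v in av₂
  ... | true  | true  = trans (∧-identityʳ _) (trans (all-cong (allFin N) same-smaller) (sym (∧-identityʳ _)))
    where
    same-smaller : ∀ u → not (true ∧ (toℕ u ℕ.<ᵇ toℕ v) ∧ sameOrbit G₁ u v) ≡ not (true ∧ (toℕ u ℕ.<ᵇ toℕ v) ∧ sameOrbit G₂ u v)
    same-smaller u = cong (λ b → not ((toℕ u ℕ.<ᵇ toℕ v) ∧ b))
      (bool-ext (λ e → sameOrbit-complete G₂ (T₂.Conn-transfer av₂ (sameOrbit-sound G₁ e)))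
                (λ e → sameOrbit-complete G₁ (T₁.Conn-transfer av₁ (sameOrbit-sound G₂ e))))
  ... | true  | false = ⊥-elim (≡true⇒≢false (T₁.avoids-transfer av₁) av₂)
  ... | false | true  = ⊥-elim (≡true⇒≢false (T₂.avoids-transfer av₂) av₁)
  ... | false | false = trans (∧-zeroʳ _) (sym (∧-zeroʳ _))

module Restriction (H : Gehm) (A : Fin (n H) → Bool) (A-r : ∀ v → A (r H v) ≡ A v)
  (h t : Fin (n H) → Fin (n H)) (t-invol : ∀ v → t (t v) ≡ v) (A-h : ∀ v → A (h v) ≡ A v)
  (t-on : ∀ v → A v ≡ true → t v ≡ h v) (t-off : ∀ v → A v ≡ false → t v ≡ r H v) where

  private
    N = n H
    g′ = gRestr H A

  σ : Fin N → Fin N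
  σ y = g H (r H y)

  fold-σ-g : ∀ k a → fold (g H a) σ k ≡ g H (fold a (r H ∘′ g H) k)
  fold-σ-g zero    a = refl
  fold-σ-g (suc k) a = cong σ (fold-σ-g k a)

  ret-first-hit : ∀ fuel j y → j ≤ fuel → (∀ i → i < j → A (fold y σ i) ≡ false) → A (fold y σ j) ≡ true →
    ret H A fuel y ≡ fold y σ j
  ret-first-hit zero       zero    y _        _      _  = refl
  ret-first-hit (suc fuel) zero    y _        _      hit = if-true hit
  ret-first-hit (suc fuel) (suc j) y (s≤s le) before hit = trans (if-false (before 0 (s≤s z≤n)))
    (trans (ret-first-hit fuel j (σ y) le (λ i lt → trans (cong A (fold-step σ i y)) (before (suc i) (s≤s lt)))
              (trans (cong A (fold-step σ j y)) hit))
           (fold-step σ j y))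

  -- Opaque, so that with-abstractions over J do not unfold the pigeonhole search.
  opaque
    first-hit : ∀ a → A a ≡ true →
      Σ ℕ λ J → J ≤ N × A (fold (g H a) σ J) ≡ true × (∀ i → i < J → A (fold (g H a) σ i) ≡ false)
    first-hit a Aa with period (r H ∘′ g H) (invol-injective (g H) (g-invol H) ∘′ invol-injective (r H) (r-invol H)) a
    ... | L , 1≤L , L≤N , back with least-ℕ (λ j → A (fold (g H a) σ j)) (L ∸ 1) (trans (cong A ends-at-ra) (trans (A-r a) Aa))
      where
      ends-at-ra : fold (g H a) σ (L ∸ 1) ≡ r H a
      ends-at-ra = trans (fold-σ-g (L ∸ 1) a)
        (trans (sym (r-invol H _)) (cong (r H) (trans (cong (fold a (r H ∘′ g H)) (m+[n∸m]≡n 1≤L)) back)))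
    ... | J , hit , J≤L-1 , before = J , ≤-trans (≤-trans J≤L-1 (m∸n≤m L 1)) L≤N , hit , before

  module _ (a : Fin N) (Aa : A a ≡ true) where

    J : ℕ
    J = proj₁ (first-hit a Aa)

    J-hit : A (fold (g H a) σ J) ≡ true
    J-hit = proj₁ (proj₂ (proj₂ (first-hit a Aa)))

    J-before : ∀ i → i < J → A (fold (g H a) σ i) ≡ false
    J-before = proj₂ (proj₂ (proj₂ (first-hit a Aa)))

    gRestr-walk : g′ a ≡ fold (g H a) σ J
    gRestr-walk = trans (if-true Aa) (ret-first-hit N J (g H a) (proj₁ (proj₂ (first-hit a Aa))) J-before J-hit)

  gRestr-A : ∀ a → A a ≡ true → A (g′ a) ≡ true
  gRestr-A a Aa = trans (cong A (gRestr-walk a Aa)) (J-hit a Aa)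

  GA GX : Gens N
  GA = g′ ∷ h ∷ []
  GX = g H ∷ t ∷ []

  Conn-fold-σ : ∀ j y → (∀ i → i < j → A (fold y σ i) ≡ false) → Conn GX (fold y σ j) y
  Conn-fold-σ zero    y _      = Conn-refl y
  Conn-fold-σ (suc j) y before = Conn-trans (step₁ _) (Conn-trans
    (step₂-≡ (sym (t-off _ (before j (n<1+n j)))))
    (Conn-fold-σ j y (λ i lt → before i (<-trans lt (n<1+n j)))))

  Conn-restrict⇒Conn : ∀ {u v} → A v ≡ true → Conn GA u v → Conn GX u v
  Conn-restrict⇒Conn = Conn-mono-on (λ x → A x ≡ true) steps
    where
    steps : ∀ {f} → f ∈ GA → ∀ x → A x ≡ true → A (f x) ≡ true × Conn GX (f x) x
    steps (here refl)         x Ax = gRestr-A x Ax , subst (λ s → Conn GX s x) (sym (gRestr-walk x Ax))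
                                       (Conn-trans (Conn-fold-σ (J x Ax) (g H x) (J-before x Ax)) (step₁ x))
    steps (there (here refl)) x Ax = trans (A-h x) Ax , step₂-≡ (sym (t-on x Ax))

  -- Walking from v along g and t, one either stands on a vertex a of A in the GA-orbit
  -- of v, or inside the stretch g a, r (g a), σ (g a), … of deleted vertices that
  -- leads from a to gRestr a.
  Segment : Fin N → Fin N → Set
  Segment v x = Σ (Fin N) λ a → Σ (A a ≡ true) λ Aa → Conn GA a v ×
    (x ≡ a ⊎ Σ ℕ λ k → k < J a Aa × (x ≡ fold (g H a) σ k ⊎ x ≡ r H (fold (g H a) σ k)))

  Segment-closed : ∀ v {f} → f ∈ GX → ∀ x → Segment v x → Segment v (f x)
  Segment-closed v (here refl) x (a , Aa , ca , inj₁ refl) with J a Aa in eJ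
  ... | zero  = g′ a , gRestr-A a Aa , Conn-trans (step₁ a) ca ,
                inj₁ (sym (trans (gRestr-walk a Aa) (cong (fold (g H a) σ) eJ)))
  ... | suc j = a , Aa , ca , inj₂ (0 , subst (0 <_) (sym eJ) (s≤s z≤n) , inj₁ refl)
  Segment-closed v (here refl) x (a , Aa , ca , inj₂ (zero , lt , inj₁ refl)) = a , Aa , ca , inj₁ (g-invol H a)
  Segment-closed v (here refl) x (a , Aa , ca , inj₂ (suc k , lt , inj₁ refl)) =
    a , Aa , ca , inj₂ (k , <-trans (n<1+n k) lt , inj₂ (g-invol H _))
  Segment-closed v (here refl) x (a , Aa , ca , inj₂ (k , lt , inj₂ refl)) with m≤n⇒m<n∨m≡n lt
  ... | inj₁ lt′ = a , Aa , ca , inj₂ (suc k , lt′ , inj₁ refl)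
  ... | inj₂ eq  = g′ a , gRestr-A a Aa , Conn-trans (step₁ a) ca ,
                   inj₁ (sym (trans (gRestr-walk a Aa) (cong (fold (g H a) σ) (sym eq))))
  Segment-closed v (there (here refl)) x (a , Aa , ca , inj₁ refl) =
    h a , trans (A-h a) Aa , Conn-trans (step₂ a) ca , inj₁ (t-on a Aa)
  Segment-closed v (there (here refl)) x (a , Aa , ca , inj₂ (k , lt , inj₁ refl)) =
    a , Aa , ca , inj₂ (k , lt , inj₂ (t-off _ (J-before a Aa k lt)))
  Segment-closed v (there (here refl)) x (a , Aa , ca , inj₂ (k , lt , inj₂ refl)) =
    a , Aa , ca , inj₂ (k , lt , inj₁ (trans (t-off _ (trans (A-r _) (J-before a Aa k lt))) (r-invol H _)))

  Conn⇒Conn-restrict : ∀ {u v} → A u ≡ true → A v ≡ true → Conn GX u v → Conn GA u v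
  Conn⇒Conn-restrict {u} {v} Au Av c with Conn-closed (Segment v) (Segment-closed v) (v , Av , Conn-refl v , inj₁ refl) c
  ... | a , Aa , ca , inj₁ refl = ca
  ... | a , Aa , ca , inj₂ (k , lt , inj₁ refl) = ⊥-elim (≡true⇒≢false Au (J-before a Aa k lt))
  ... | a , Aa , ca , inj₂ (k , lt , inj₂ refl) = ⊥-elim (≡true⇒≢false Au (trans (A-r _) (J-before a Aa k lt)))

  numOrbits-restrict : numOrbits A GA ≡ numOrbits A GX
  numOrbits-restrict = numOrbits-cong A GA GX (λ _ Av → Conn-restrict⇒Conn Av) Conn⇒Conn-restrict

  numOrbits-restrict-isolates : numOrbits A GA + newIsolates H A ≡ numOrbits everywhere GX
  numOrbits-restrict-isolates = begin
    numOrbits A GA + newIsolates H A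
      ≡⟨ cong (ℕ._+ newIsolates H A) numOrbits-restrict ⟩
    numOrbits A GX + newIsolates H A
      ≡⟨ cong₂ _+_ (sym (C.numClasses-meeting A)) (sym (countB-cong (allFin N) Av.avoiding-rep-cong)) ⟩
    meeting + avoiding
      ≡⟨ +-comm meeting avoiding ⟩
    avoiding + meeting
      ≡⟨ countB-split (isRep everywhere GX) (C.avoids A) (allFin N) ⟨
    numOrbits everywhere GX ∎
    where
    open ≡-Reasoning
    module C = Classes (sameOrbit-isEquivalence GX (invol₂ (g-invol H) t-invol))
    module Av = AvoidingOrbits A (g H) t (r H) (g-invol H) t-invol (r-invol H) t-off
    meeting avoiding : ℕ
    meeting = countB (λ v → isRep everywhere GX v ∧ not (C.avoids A v)) (allFin N)
    avoiding = countB (λ v → isRep everywhere GX v ∧ C.avoids A v) (allFin N)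

toℚᵘ-/1 : ∀ z → toℚᵘ (z / 1) ≃ᵘ mkℚᵘ z 0
toℚᵘ-/1 z = toℚᵘ-fromℚᵘ (mkℚᵘ z 0)

toℚᵘ-/2 : ∀ z → toℚᵘ (z / 2) ≃ᵘ mkℚᵘ z 1
toℚᵘ-/2 z = toℚᵘ-fromℚᵘ (mkℚᵘ z 1)

toℚᵘ-homo-− : ∀ p q → toℚᵘ (p ℚ.- q) ≃ᵘ (toℚᵘ p ℚᵘ.- toℚᵘ q)
toℚᵘ-homo-− p q = ≃-trans (toℚᵘ-homo-+ p (ℚ.- q)) (+-cong (≃-refl {toℚᵘ p}) (toℚᵘ-homo‿- q))

ρ-formula : ∀ (v k e d f : ℤ) →
  (v / 1 ℚ.- k / 1) ℚ.+ ½ ℚ.* ((((((+ 2 ℤ.* k) ℤ.- v) ℤ.- e) ℤ.+ d) ℤ.- f) / 1) ≡ ((v ℤ.+ d) ℤ.- (e ℤ.+ f)) / 2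
ρ-formula v k e d f = toℚᵘ-injective (≃-trans lhs (≃-trans core (≃-sym (toℚᵘ-/2 _))))
  where
  γ = ((((+ 2 ℤ.* k) ℤ.- v) ℤ.- e) ℤ.+ d) ℤ.- f
  cross-multiplied : ∀ (v k e d f : ℤ) →
    ((v ℤ.* + 1 ℤ.+ ℤ.- k ℤ.* + 1) ℤ.* + 2 ℤ.+ (+ 1 ℤ.* (((((+ 2 ℤ.* k) ℤ.- v) ℤ.- e) ℤ.+ d) ℤ.- f)) ℤ.* + 1) ℤ.* + 2
      ≡ ((v ℤ.+ d) ℤ.- (e ℤ.+ f)) ℤ.* + 2
  cross-multiplied = solve-∀
  core : ((mkℚᵘ v 0 ℚᵘ.- mkℚᵘ k 0) ℚᵘ.+ mkℚᵘ (+ 1) 1 ℚᵘ.* mkℚᵘ γ 0) ≃ᵘ mkℚᵘ ((v ℤ.+ d) ℤ.- (e ℤ.+ f)) 1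
  core = *≡* (cross-multiplied v k e d f)
  lhs : toℚᵘ ((v / 1 ℚ.- k / 1) ℚ.+ ½ ℚ.* (γ / 1)) ≃ᵘ ((mkℚᵘ v 0 ℚᵘ.- mkℚᵘ k 0) ℚᵘ.+ mkℚᵘ (+ 1) 1 ℚᵘ.* mkℚᵘ γ 0)
  lhs = ≃-trans (toℚᵘ-homo-+ (v / 1 ℚ.- k / 1) (½ ℚ.* (γ / 1))) (+-cong
    (≃-trans (toℚᵘ-homo-− (v / 1) (k / 1)) (+-cong (toℚᵘ-/1 v) (-‿cong (toℚᵘ-/1 k))))
    (≃-trans (toℚᵘ-homo-* ½ (γ / 1)) (*-cong (≃-refl {mkℚᵘ (+ 1) 1}) (toℚᵘ-/1 γ))))

ρD-half : ∀ D → ρD D ≡ (+ (vD D ℕ.+ dD D) ℤ.- + (eD D ℕ.+ fD D)) / 2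
ρD-half D = trans (cong (λ K → (+ v / 1 ℚ.- + k / 1) ℚ.+ ½ ℚ.* (((((K ℤ.- + v) ℤ.- + e) ℤ.+ + d) ℤ.- + f) / 1)) (pos-* 2 k))
  (trans (ρ-formula (+ v) (+ k) (+ e) (+ d) (+ f)) (cong₂ (λ a b → (a ℤ.- b) / 2) (sym (pos-+ v d)) (sym (pos-+ e f))))
  where
  v = vD D
  k = kD D
  e = eD D
  d = dD D
  f = fD D

pos-cast : ∀ {x y z w m} → x ℕ.+ y ≡ z ℕ.+ w ℕ.+ 2 ℕ.* m → + x ℤ.+ + y ≡ (+ z ℤ.+ + w) ℤ.+ + 2 ℤ.* + m
pos-cast {x} {y} {z} {w} {m} h =
  trans (sym (pos-+ x y)) (trans (cong +_ h) (trans (pos-+ (z ℕ.+ w) (2 ℕ.* m)) (cong₂ ℤ._+_ (pos-+ z w) (pos-* 2 m))))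

half-difference : ∀ a b c d {m} → a ℕ.+ d ≡ c ℕ.+ b ℕ.+ 2 ℕ.* m →
  (+ a ℤ.- + b) / 2 ℚ.- (+ c ℤ.- + d) / 2 ≡ + m / 1
half-difference a b c d {m} h = toℚᵘ-injective (≃-trans lhs (≃-trans core (≃-sym (toℚᵘ-/1 (+ m)))))
  where
  x = + a ℤ.- + b
  y = + c ℤ.- + d
  lhs : toℚᵘ (x / 2 ℚ.- y / 2) ≃ᵘ (mkℚᵘ x 1 ℚᵘ.- mkℚᵘ y 1)
  lhs = ≃-trans (toℚᵘ-homo-− (x / 2) (y / 2)) (+-cong (toℚᵘ-/2 x) (-‿cong (toℚᵘ-/2 y)))
  regroup : ∀ (a b c d : ℤ) → ((a ℤ.- b) ℤ.* + 2 ℤ.+ ℤ.- (c ℤ.- d) ℤ.* + 2) ℤ.* + 1 ≡ ((a ℤ.+ d) ℤ.- (c ℤ.+ b)) ℤ.* + 2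
  regroup = solve-∀
  cancel : ∀ (s m : ℤ) → ((s ℤ.+ + 2 ℤ.* m) ℤ.- s) ℤ.* + 2 ≡ m ℤ.* + 4
  cancel = solve-∀
  core : (mkℚᵘ x 1 ℚᵘ.- mkℚᵘ y 1) ≃ᵘ mkℚᵘ (+ m) 0
  core = *≡* (trans (regroup (+ a) (+ b) (+ c) (+ d))
    (trans (cong (λ s → (s ℤ.- (+ c ℤ.+ + b)) ℤ.* + 2) (pos-cast {a} {d} {c} {b} {m} h)) (cancel (+ c ℤ.+ + b) (+ m))))

whole-minus-half : ∀ p q c d {m} → 2 ℕ.* p ℕ.+ d ≡ 2 ℕ.* q ℕ.+ c ℕ.+ 2 ℕ.* m →
  (+ p / 1 ℚ.- + q / 1) ℚ.- (+ c ℤ.- + d) / 2 ≡ + m / 1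
whole-minus-half p q c d {m} h = toℚᵘ-injective (≃-trans lhs (≃-trans core (≃-sym (toℚᵘ-/1 (+ m)))))
  where
  y = + c ℤ.- + d
  lhs : toℚᵘ ((+ p / 1 ℚ.- + q / 1) ℚ.- y / 2) ≃ᵘ ((mkℚᵘ (+ p) 0 ℚᵘ.- mkℚᵘ (+ q) 0) ℚᵘ.- mkℚᵘ y 1)
  lhs = ≃-trans (toℚᵘ-homo-− (+ p / 1 ℚ.- + q / 1) (y / 2))
    (+-cong (≃-trans (toℚᵘ-homo-− (+ p / 1) (+ q / 1)) (+-cong (toℚᵘ-/1 (+ p)) (-‿cong (toℚᵘ-/1 (+ q)))))
            (-‿cong (toℚᵘ-/2 y)))
  regroup : ∀ (p q c d : ℤ) → ((p ℤ.* + 1 ℤ.+ ℤ.- q ℤ.* + 1) ℤ.* + 2 ℤ.+ ℤ.- (c ℤ.- d) ℤ.* + 1) ℤ.* + 1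
    ≡ (+ 2 ℤ.* p ℤ.+ d) ℤ.- (+ 2 ℤ.* q ℤ.+ c)
  regroup = solve-∀
  cancel : ∀ (s m : ℤ) → (s ℤ.+ + 2 ℤ.* m) ℤ.- s ≡ m ℤ.* + 2
  cancel = solve-∀
  core : ((mkℚᵘ (+ p) 0 ℚᵘ.- mkℚᵘ (+ q) 0) ℚᵘ.- mkℚᵘ y 1) ≃ᵘ mkℚᵘ (+ m) 0
  core = *≡* (trans (regroup (+ p) (+ q) (+ c) (+ d))
    (trans (cong₂ (λ s t → s ℤ.- t) (trans (cong (ℤ._+ + d) (sym (pos-* 2 p))) (pos-cast {2 ℕ.* p} {d} {2 ℕ.* q} {c} {m} h))
                                     (cong (ℤ._+ + c) (sym (pos-* 2 q))))
           (cancel (+ (2 ℕ.* q) ℤ.+ + c) (+ m))))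

-- 2ρ(H) − 2ρ(A) = 2m with vD, dD, eD, fD of H and of H_{|A} written out in terms of
-- orbit and edge counts, stated additively to avoid truncated subtraction.
ρ-gap-arithmetic : ∀ (V E Gs Obs dH dA VA NI NA EA EB FA F Nb iso m : ℕ) →
  V ≡ VA + NI → E ≡ EA + EB → Gs ≡ FA + NI → Obs ≡ NA + EB → dH ≡ Nb → dA ≡ NA → Gs + Nb ≡ F + Obs + 2 * m →
  (V + iso + dH) + (EA + (FA + (iso + NI))) ≡ (VA + (iso + NI) + dA) + (E + (F + iso)) + 2 * m
ρ-gap-arithmetic _ _ _ _ _ _ VA NI NA EA EB FA F Nb iso m refl refl refl refl refl refl h = begin
  (VA + NI + iso + Nb) + (EA + (FA + (iso + NI)))      ≡⟨ regroup VA NI iso Nb EA FA ⟩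
  (FA + NI + Nb) + (VA + NI + EA + iso + iso)          ≡⟨ cong (ℕ._+ (VA + NI + EA + iso + iso)) h ⟩
  (F + (NA + EB) + 2 * m) + (VA + NI + EA + iso + iso) ≡⟨ regroup′ VA NI NA EA EB F iso m ⟩
  (VA + (iso + NI) + NA) + (EA + EB + (F + iso)) + 2 * m ∎
  where
  open ≡-Reasoning
  regroup : ∀ VA NI iso Nb EA FA →
    (VA + NI + iso + Nb) + (EA + (FA + (iso + NI))) ≡ (FA + NI + Nb) + (VA + NI + EA + iso + iso)
  regroup = solve-∀ℕ
  regroup′ : ∀ VA NI NA EA EB F iso m →
    (F + (NA + EB) + 2 * m) + (VA + NI + EA + iso + iso) ≡ (VA + (iso + NI) + NA) + (EA + EB + (F + iso)) + 2 * m
  regroup′ = solve-∀ℕ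

nullity-gap-arithmetic : ∀ (V Gs Ors Nr dA VA NI NA NBr EA FA iso m : ℕ) →
  V ≡ VA + NI → Gs ≡ FA + NI → Ors ≡ EA + NBr → Nr ≡ NA + NBr → dA ≡ NA → Gs + Nr ≡ V + Ors + 2 * m →
  2 * dA + (EA + (FA + (iso + NI))) ≡ 2 * EA + (VA + (iso + NI) + dA) + 2 * m
nullity-gap-arithmetic _ _ _ _ _ VA NI NA NBr EA FA iso m refl refl refl refl refl h = ℕP.+-cancelʳ-≡ NBr _ _ (begin
  2 * NA + (EA + (FA + (iso + NI))) + NBr               ≡⟨ regroup VA NI NA NBr EA FA iso ⟩
  (FA + NI + (NA + NBr)) + (NA + EA + iso)              ≡⟨ cong (ℕ._+ (NA + EA + iso)) h ⟩
  (VA + NI + (EA + NBr) + 2 * m) + (NA + EA + iso)      ≡⟨ regroup′ VA NI NA NBr EA iso m ⟩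
  2 * EA + (VA + (iso + NI) + NA) + 2 * m + NBr         ∎)
  where
  open ≡-Reasoning
  regroup : ∀ VA NI NA NBr EA FA iso →
    2 * NA + (EA + (FA + (iso + NI))) + NBr ≡ (FA + NI + (NA + NBr)) + (NA + EA + iso)
  regroup = solve-∀ℕ
  regroup′ : ∀ VA NI NA NBr EA iso m →
    (VA + NI + (EA + NBr) + 2 * m) + (NA + EA + iso) ≡ 2 * EA + (VA + (iso + NI) + NA) + 2 * m + NBr
  regroup′ = solve-∀ℕ

module Gaps (H : Gehm) (bip : Orientable H) (A : HyperedgeSet H) where
  private
    N = n H
    c = proj₁ bip
    b-bip = proj₁ (proj₂ bip)
    g-bip = proj₁ (proj₂ (proj₂ bip))
    r-bip = proj₂ (proj₂ (proj₂ bip))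
    Af = proj₁ A
    A-b = proj₁ (proj₂ A)
    A-r = proj₂ (proj₂ A)

  B : Fin N → Bool
  B v = not (Af v)

  s : Fin N → Fin N
  s v = if Af v then b H v else r H v

  s-on : ∀ v → Af v ≡ true → s v ≡ b H v
  s-on v = if-true

  s-off : ∀ v → Af v ≡ false → s v ≡ r H v
  s-off v = if-false

  A-s : ∀ v → Af (s v) ≡ Af v
  A-s v with Af v in Av
  ... | true  = trans (A-b v) Av
  ... | false = trans (A-r v) Av

  s-invol : ∀ v → s (s v) ≡ v
  s-invol v with Af v in Av
  ... | true  = trans (s-on (b H v) (trans (A-b v) Av)) (b-invol H v)
  ... | false = trans (s-off (r H v) (trans (A-r v) Av)) (r-invol H v)

  s-bip : ∀ v → c (s v) ≢ c v
  s-bip v with Af v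
  ... | true  = b-bip v
  ... | false = r-bip v

  B-pres : ∀ {f : Fin N → Fin N} → (∀ x → Af (f x) ≡ Af x) → ∀ x → B (f x) ≡ B x
  B-pres A-f x = cong not (A-f x)

  on-A : ∀ {f : Fin N → Fin N} → (∀ x → Af (f x) ≡ Af x) → ∀ x → Af x ≡ true → Af (f x) ≡ true
  on-A A-f x Ax = trans (A-f x) Ax

  on-B : ∀ {f : Fin N → Fin N} → (∀ x → Af (f x) ≡ Af x) → ∀ x → B x ≡ true → B (f x) ≡ true
  on-B A-f x Bx = trans (B-pres A-f x) Bx

  NI VA FA EA EB NA NBr Nb Nr : ℕ
  NI  = newIsolates H Af
  VA  = numOrbits Af (gRestr H Af ∷ r H ∷ [])
  FA  = numOrbits Af (b H ∷ gRestr H Af ∷ [])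
  EA  = numOrbits Af (b H ∷ r H ∷ [])
  EB  = numOrbits B (b H ∷ r H ∷ [])
  NA  = numEdges Af (b H)
  NBr = numEdges B (r H)
  Nb  = numEdges everywhere (b H)
  Nr  = numEdges everywhere (r H)

  orbits : (Fin N → Fin N) → (Fin N → Fin N) → ℕ
  orbits f h = numOrbits everywhere (f ∷ h ∷ [])

  gr-orbits : orbits (g H) (r H) ≡ VA + NI
  gr-orbits = sym (Restriction.numOrbits-restrict-isolates H Af A-r (r H) (r H) (r-invol H) A-r (λ _ _ → refl) (λ _ _ → refl))

  gs-orbits : orbits (g H) s ≡ FA + NI
  gs-orbits = sym (trans (cong (ℕ._+ NI) (numOrbits-comm Af (b H) (gRestr H Af)))
    (Restriction.numOrbits-restrict-isolates H Af A-r (b H) s s-invol A-b s-on s-off))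

  bs-orbits : orbits (b H) s ≡ NA + EB
  bs-orbits = trans (numOrbits-partition Af _ (invol₂ (b-invol H) s-invol) (preserves₂ Af A-b A-s))
    (cong₂ _+_ (PerfectMatching.numOrbits-matching Af (b H) (b-invol H) (b-noloop H) A-b s s-on)
               (numOrbits-on B (b H) (b H) s (r H) (on-B A-b) (on-B A-s) (λ _ _ → refl) (λ x Bx → s-off x (not⁻ Bx))))

  br-orbits : orbits (b H) (r H) ≡ EA + EB
  br-orbits = numOrbits-partition Af _ (invol₂ (b-invol H) (r-invol H)) (preserves₂ Af A-b A-r)

  rs-orbits : orbits (r H) s ≡ EA + NBr
  rs-orbits = trans (numOrbits-partition Af _ (invol₂ (r-invol H) s-invol) (preserves₂ Af A-r A-s))
    (cong₂ _+_ (trans (numOrbits-on Af (r H) (r H) s (b H) (on-A A-r) (on-A A-s) (λ _ _ → refl) s-on)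
                      (numOrbits-comm Af (r H) (b H)))
               (PerfectMatching.numOrbits-matching B (r H) (r-invol H) (r-noloop H) (B-pres A-r) s (λ x Bx → s-off x (not⁻ Bx))))

  r-edges : Nr ≡ NA + NBr
  r-edges = trans (numEdges-partition Af (r H))
    (cong (ℕ._+ NBr) (numEdges-independent Af (r H) (b H) (r-invol H) (r-noloop H) A-r (b-invol H) (b-noloop H) A-b))

  halved : ∀ {x y} → y ≡ x → ⌊ x + y /2⌋ ≡ x
  halved {x} refl = sym (n≡⌊n+n/2⌋ x)

  dH-edges : dD (toData H) ≡ Nb
  dH-edges = halved (numEdges-independent everywhere (r H) (b H) (r-invol H) (r-noloop H) (λ _ → refl)
                                                              (b-invol H) (b-noloop H) (λ _ → refl))

  dA-edges : dA H A ≡ NA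
  dA-edges = halved (numEdges-independent Af (r H) (b H) (r-invol H) (r-noloop H) A-r (b-invol H) (b-noloop H) A-b)

  ρ-gap : Σ ℕ λ m → (vD (toData H) + dD (toData H)) + (eD (restrict H Af) + fD (restrict H Af))
                  ≡ (vD (restrict H Af) + dD (restrict H Af)) + (eD (toData H) + fD (toData H)) + 2 * m
  ρ-gap with Triangle.triangle (b H) (g H) (b-invol H) (g-invol H) c b-bip g-bip s s-invol s-bip
  ... | m , defect = m , ρ-gap-arithmetic (orbits (g H) (r H)) (orbits (b H) (r H)) (orbits (g H) s) (orbits (b H) s)
    (dD (toData H)) (dA H A) VA NI NA EA EB FA (orbits (b H) (g H)) Nb (iso H) m
    gr-orbits br-orbits gs-orbits bs-orbits dH-edges dA-edges defect

  nullity-gap : Σ ℕ λ m → 2 * dA H A + (eD (restrict H Af) + fD (restrict H Af))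
                        ≡ 2 * card H A + (vD (restrict H Af) + dD (restrict H Af)) + 2 * m
  nullity-gap with Triangle.triangle (r H) (g H) (r-invol H) (g-invol H) c r-bip g-bip s s-invol s-bip
  ... | m , defect = m , nullity-gap-arithmetic (orbits (r H) (g H)) (orbits (g H) s) (orbits (r H) s) Nr
    (dA H A) VA NI NA NBr EA FA (iso H) m
    (trans (numOrbits-comm everywhere (r H) (g H)) gr-orbits) gs-orbits rs-orbits r-edges dA-edges defect

proposition3 : (H : Gehm) → Orientable H → (A : HyperedgeSet H) →
    ((ρ H - ρA H A) ≡ℕ)
    × ((((+ dA H A) / 1 - (+ card H A) / 1) - ρA H A) ≡ℕ)
proposition3 H bip A = (proj₁ ρ-gap , ρ-difference) , (proj₁ nullity-gap , nullity-difference)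
  where
  open Gaps H bip A using (ρ-gap; nullity-gap)
  DH = toData H
  DA = restrict H (proj₁ A)
  ρ-difference : ρ H - ρA H A ≡ + proj₁ ρ-gap / 1
  ρ-difference = trans (cong₂ _-_ (ρD-half DH) (ρD-half DA))
    (half-difference (vD DH + dD DH) (eD DH + fD DH) (vD DA + dD DA) (eD DA + fD DA) {proj₁ ρ-gap} (proj₂ ρ-gap))
  nullity-difference : ((+ dA H A) / 1 - (+ card H A) / 1) - ρA H A ≡ + proj₁ nullity-gap / 1
  nullity-difference = trans (cong (((+ dA H A) / 1 - (+ card H A) / 1) -_) (ρD-half DA))
    (whole-minus-half (dA H A) (card H A) (vD DA + dD DA) (eD DA + fD DA) {proj₁ nullity-gap} (proj₂ nullity-gap))
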